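{- Let $S_1,\dots,S_k$ be the sections of a Q-node in an MPQ-tree $\mathcal{T}$, and set $S_0=S_{k+1}=\emptyset$. For every pair of indices $1\le a<b\le k$ with $(a,b)\neq(1,k)$ there is a vertex $v\in\big((S_{a-1}\cap S_a)\setminus S_b\big)\cup\big((S_b\cap S_{b+1})\setminus S_a\big)$.
   Context: MPQ-trees (Korte–Möhring) encode an interval graph $G$ (the intersection graph of a finite family of closed intervals): a rooted ordered tree of P-nodes and Q-nodes; each vertex of $G$ is assigned to exactly one node. A P-node carries a (possibly empty) set of vertices. A Q-node with children $T_1,\dots,T_k$ carries sections $S_1,\dots,S_k$ (sets of vertices); each vertex assigned to a Q-node lies in a consecutive run of at least two of its sections. For each leaf, the vertices on the root-to-leaf path (P-node sets and, for Q-nodes, the section whose child the path enters) form a maximal clique, each maximal clique arises exactly once, and the orderings of maximal cliques obtainable by permuting children of P-nodes and reversing Q-nodes are exactly the orderings in which each vertex occupies a consecutive block of cliques. $V_i$ is the set of vertices assigned to nodes of $T_i$. The trees considered are those produced by the standard construction and satisfy, for every Q-node with $k$ sections: $V_1,V_k\neq\emptyset$, and $(S_{i-1}\cup V_{i-1})\setminus S_i\neq\emptyset$ and $(S_i\cup V_i)\setminus S_{i-1}\neq\emptyset$ for $2\le i\le k$. -}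

module Defs where

open import Data.Nat using (ℕ; zero; suc; _+_; _≤_; _<_)
open import Data.Bool using (if_then_else_)
open import Data.Fin using (Fin)
open import Data.Fin.Subset using (Subset; _∈_; _∉_; _⊆_; _∪_; ⊥)
open import Data.Vec using (lookup)
open import Data.List using (List; []; _∷_; [_]; map; _++_; reverse; length)
open import Data.List.Relation.Unary.All using (All)
open import Data.List.Relation.Unary.Unique.Propositional using (Unique)
open import Data.List.Relation.Binary.Permutation.Propositional using (_↭_)
import Data.List.Membership.Propositional as LM
open import Data.Product using (Σ; _×_; _,_; ∃)
open import Function.Bundles using (_⇔_)
open import Relation.Nullary using (¬_)
open import Relation.Binary.PropositionalEquality using (_≡_; _≢_)

private variable n : ℕ

record Graph (n : ℕ) : Set₁ where
  field
    Adj    : Fin n → Fin n → Set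
    sym    : ∀ {u v} → Adj u v → Adj v u
    irrefl : ∀ {v} → ¬ Adj v v
open Graph public

-- G is the intersection graph of a family of closed intervals [l v , r v].
-- (For a finite family, integer/natural endpoints are w.l.o.g.)
IsIntervalGraph : Graph n → Set
IsIntervalGraph {n} G =
  Σ (Fin n → ℕ) λ l → Σ (Fin n → ℕ) λ r →
    (∀ v → l v ≤ r v) ×
    (∀ u v → u ≢ v → (Adj G u v ⇔ (l u ≤ r v × l v ≤ r u)))

IsClique : Graph n → Subset n → Set
IsClique G C = ∀ u v → u ∈ C → v ∈ C → u ≢ v → Adj G u v

IsMaxClique : Graph n → Subset n → Set
IsMaxClique G C = IsClique G C × (∀ D → IsClique G D → C ⊆ D → D ≡ C)

-- A P-node carries a vertex set and an ordered list of
-- children (a leaf is a P-node without children).  A Q-node carries the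
-- list of pairs (S_i , T_i) : section S_i and the i-th child T_i.

data Tree (n : ℕ) : Set where
  P : Subset n → List (Tree n) → Tree n
  Q : List (Subset n × Tree n) → Tree n

secUnion : List (Subset n × Tree n) → Subset n
secUnion []              = ⊥
secUnion ((s , _) ∷ ss)  = s ∪ secUnion ss

mutual
  verts : Tree n → Subset n
  verts (P s ts) = s ∪ vertsL ts
  verts (Q ss)   = vertsQ ss

  vertsL : List (Tree n) → Subset n
  vertsL []       = ⊥
  vertsL (t ∷ ts) = verts t ∪ vertsL ts

  vertsQ : List (Subset n × Tree n) → Subset n
  vertsQ []             = ⊥
  vertsQ ((s , t) ∷ ss) = s ∪ verts t ∪ vertsQ ss

mutual
  nodeSets : Tree n → List (Subset n)
  nodeSets (P s ts) = s ∷ nodeSetsL ts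
  nodeSets (Q ss)   = secUnion ss ∷ nodeSetsQ ss

  nodeSetsL : List (Tree n) → List (Subset n)
  nodeSetsL []       = []
  nodeSetsL (t ∷ ts) = nodeSets t ++ nodeSetsL ts

  nodeSetsQ : List (Subset n × Tree n) → List (Subset n)
  nodeSetsQ []             = []
  nodeSetsQ ((_ , t) ∷ ss) = nodeSets t ++ nodeSetsQ ss

mutual
  subtrees : Tree n → List (Tree n)
  subtrees (P s ts) = P s ts ∷ subtreesL ts
  subtrees (Q ss)   = Q ss ∷ subtreesQ ss

  subtreesL : List (Tree n) → List (Tree n)
  subtreesL []       = []
  subtreesL (t ∷ ts) = subtrees t ++ subtreesL ts

  subtreesQ : List (Subset n × Tree n) → List (Tree n)
  subtreesQ []             = []
  subtreesQ ((_ , t) ∷ ss) = subtrees t ++ subtreesQ ss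

mutual
  -- root-to-leaf path cliques, in the canonical left-to-right leaf order
  leaves : Tree n → List (Subset n)
  leaves (P s [])       = [ s ]
  leaves (P s (t ∷ ts)) = map (s ∪_) (leavesL (t ∷ ts))
  leaves (Q ss)         = leavesQ ss

  leavesL : List (Tree n) → List (Subset n)
  leavesL []       = []
  leavesL (t ∷ ts) = leaves t ++ leavesL ts

  leavesQ : List (Subset n × Tree n) → List (Subset n)
  leavesQ []             = []
  leavesQ ((s , t) ∷ ss) = map (s ∪_) (leaves t) ++ leavesQ ss

-- Front T L : L is a leaf-clique ordering obtainable from T by permuting
-- children of P-nodes and reversing Q-nodes (at every node).
mutual
  data Front {n : ℕ} : Tree n → List (Subset n) → Set where
    leafF : ∀ {s} → Front (P s []) [ s ]
    pF    : ∀ {s t ts ts' L} → ts' ↭ (t ∷ ts) → FrontL ts' L →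
            Front (P s (t ∷ ts)) (map (s ∪_) L)
    qF    : ∀ {ss L} → FrontQ ss L → Front (Q ss) L
    qRevF : ∀ {ss L} → FrontQ (reverse ss) L → Front (Q ss) L

  data FrontL {n : ℕ} : List (Tree n) → List (Subset n) → Set where
    []F  : FrontL [] []
    _∷F_ : ∀ {t ts L M} → Front t L → FrontL ts M → FrontL (t ∷ ts) (L ++ M)

  data FrontQ {n : ℕ} : List (Subset n × Tree n) → List (Subset n) → Set where
    []F  : FrontQ [] []
    _∷F_ : ∀ {s t ss L M} → Front t L → FrontQ ss M →
           FrontQ ((s , t) ∷ ss) (map (s ∪_) L ++ M)

occ : Fin n → List (Subset n) → ℕ
occ v []      = 0
occ v (S ∷ L) = (if lookup S v then 1 else 0) + occ v L

-- 0-based indexing into a list of subsets, ∅ outside the range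
at : List (Subset n) → ℕ → Subset n
at []      _       = ⊥
at (S ∷ L) zero    = S
at (S ∷ L) (suc i) = at L i

Consecutive : List (Subset n) → Set
Consecutive L = ∀ v i j k → i ≤ j → j ≤ k →
  v ∈ at L i → v ∈ at L k → v ∈ at L j

-- 1-based section S_i of a Q-node; S_0 = S_{k+1} = ∅ (and ∅ beyond)
sec : List (Subset n × Tree n) → ℕ → Subset n
sec ss      zero          = ⊥
sec []      (suc i)       = ⊥
sec ((s , _) ∷ ss) (suc zero)    = s
sec (_ ∷ ss) (suc (suc i)) = sec ss (suc i)

-- 1-based V_i : vertices assigned to nodes of the i-th child T_i (∅ outside)
childV : List (Subset n × Tree n) → ℕ → Subset n
childV ss      zero          = ⊥
childV []      (suc i)       = ⊥
childV ((_ , t) ∷ ss) (suc zero)    = verts t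
childV (_ ∷ ss) (suc (suc i)) = childV ss (suc i)

SectionRun : List (Subset n × Tree n) → Fin n → Set
SectionRun ss v = ∃ λ l → ∃ λ r → l < r × (∀ i → (v ∈ sec ss i ⇔ (l ≤ i × i ≤ r)))

QNondeg : List (Subset n × Tree n) → Set
QNondeg ss =
  (∃ λ v → v ∈ childV ss 1) × (∃ λ v → v ∈ childV ss (length ss)) ×
  (∀ i → 2 ≤ i → i ≤ length ss →
     (∃ λ v → v ∈ (sec ss (i Data.Nat.∸ 1) ∪ childV ss (i Data.Nat.∸ 1)) × v ∉ sec ss i) ×
     (∃ λ v → v ∈ (sec ss i ∪ childV ss i) × v ∉ sec ss (i Data.Nat.∸ 1)))

record IsMPQTree (G : Graph n) (T : Tree n) : Set₁ where
  field
    assignedOnce  : ∀ v → occ v (nodeSets T) ≡ 1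
    qRuns         : ∀ ss → Q ss LM.∈ subtrees T → ∀ v → v ∈ secUnion ss → SectionRun ss v
    leavesMax     : All (IsMaxClique G) (leaves T)
    leavesUnique  : Unique (leaves T)
    leavesAll     : ∀ C → IsMaxClique G C → C LM.∈ leaves T
    orderings     : ∀ L → L ↭ leaves T → (Front T L ⇔ Consecutive L)
    qNondeg       : ∀ ss → Q ss LM.∈ subtrees T → QNondeg ss

-- Suppose no vertex separates the block of sections S_a … S_b from its neighbours, i.e. every
-- vertex of S_{a-1} ∩ S_a lies in S_b and every vertex of S_b ∩ S_{b+1} lies in S_a. Reverse, in
-- the canonical clique ordering of T, the cliques through the children a … b of the Q-node.
-- Every vertex still occupies a consecutive run: one that enters the block from the left,
-- through the last clique before it, also lies in the block's last clique, for otherwise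
-- (being assigned to a single node) it lies in S_{a-1} ∩ S_a but not in S_b, or, when a = 1,
-- it violates the ordering in which the whole Q-node is reversed; symmetrically on the right.
-- So the new ordering is a front of T. In a front, however, the children of a Q-node occur all
-- in order or all reversed, whereas the new ordering keeps a clique of child a-1 (or b+1)
-- where it was but turns the block around. Hence the block has no neighbour: (a, b) = (1, k).
module Submission where

open import Defs hiding (sym)
open import Data.Bool using (Bool; true; false; if_then_else_)
open import Data.Empty using (⊥; ⊥-elim)
open import Data.Fin using (Fin)
open import Data.Fin.Properties using (any?)
open import Data.Fin.Subset using (Subset; _∈_; _∉_; _⊆_; _∪_) renaming (⊥ to ∅)
open import Data.Fin.Subset.Properties
  using (_∈?_; x∈p∪q⁻; x∈p∪q⁺; p⊆p∪q; q⊆p∪q; ∉⊥; ⊆-reflexive; ∪-assoc; ∪-identityˡ)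
open import Data.List
  using (List; []; _∷_; _++_; _∷ʳ_; map; reverse; head; last; length; initLast; _∷ʳ′_)
open import Data.List.Properties
  using (++-assoc; ++-identityʳ; map-++; map-∘; map-cong; map-id; reverse-++; unfold-reverse; reverse-map;
         head-map; last-map; length-++; length-++-sucʳ)
import Data.List.Membership.Propositional as LM
open import Data.List.Membership.Propositional using () renaming (_∈_ to _∈ₗ_)
open import Data.List.Membership.Propositional.Properties using (∈-∃++; ∈-++⁻; ∈-++⁺ˡ; ∈-++⁺ʳ; ∈-map⁺; ∈-map⁻)
open import Data.List.Relation.Unary.All using (All; []; _∷_)
open import Data.List.Relation.Unary.All.Properties using (All¬⇒¬Any)
open import Data.List.Relation.Unary.AllPairs using (_∷_)
open import Data.List.Relation.Unary.Any using (Any; here; there)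
import Data.List.Relation.Unary.Any.Properties as Any
open import Data.List.Relation.Unary.Unique.Propositional using (Unique)
open import Data.List.Relation.Binary.Permutation.Propositional
  using (_↭_; ↭-refl; ↭-sym; ↭-trans; ↭-reflexive; ↭⇒↭ₛ)
import Data.List.Relation.Binary.Permutation.Propositional as ↭
open import Data.List.Relation.Binary.Permutation.Propositional.Properties
  using (All-resp-↭; ∈-resp-↭; ↭-reverse; ++⁺ˡ; ++⁺ʳ; ++⁺; ++-comm; shifts; map⁺)
import Data.List.Relation.Binary.Permutation.Setoid.Properties as PermutationSetoid
import Data.Maybe as Maybe
open import Data.Vec using (lookup)
open import Data.Vec.Properties using ([]=⇒lookup; lookup⇒[]=; lookup-replicate)
open import Data.Maybe using (just; nothing)
open import Data.Maybe.Properties using (just-injective)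
open import Data.Nat using (ℕ; zero; suc; _+_; _∸_; _≤_; _<_; z≤n; s≤s)
open import Data.Nat.Properties using (≤-refl; ≤-trans; ≤-reflexive; m≤m+n; m≤n+m; +-mono-≤; +-assoc; +-comm)
import Data.Product as Product
open import Data.Product using (∃; ∃₂; _×_; _,_; map₂)
import Data.Sum as Sum
open import Data.Sum using (_⊎_; inj₁; inj₂)
open import Function using (_∘_; case_of_)
open import Function.Bundles using (Equivalence)
open import Relation.Nullary using (¬_; yes; no; ¬?)
open import Relation.Nullary.Decidable using (_×-dec_; _⊎-dec_)
open import Relation.Unary using (Decidable)
open import Relation.Binary.PropositionalEquality
  using (_≡_; _≢_; refl; sym; trans; cong; cong₂; subst; setoid)
open Relation.Binary.PropositionalEquality.≡-Reasoning

-- Convex bit lists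

data Phase : Set where
  before inside after : Phase

private variable
  b : Bool
  bs bs′ : List Bool
  σ σ′ μ : Phase

data Step : Phase → Bool → Phase → Set where
  wait  : Step before false before
  enter : Step before true  inside
  stay  : Step inside true  inside
  leave : Step inside false after
  done  : Step after  false after

data Run : Phase → List Bool → Phase → Set where
  []  : Run σ [] σ
  _∷_ : Step σ b μ → Run μ bs σ′ → Run σ (b ∷ bs) σ′

-- accepted by the automaton for false* true* false*: the trues form one block
Convex : List Bool → Set
Convex bs = ∃ (Run before bs)

Trues Falses : List Bool → Set
Trues  = All (_≡ true)
Falses = All (_≡ false)

rank : Phase → ℕ
rank before = 0
rank inside = 1
rank after  = 2

step-rank : Step σ b σ′ → rank σ ≤ rank σ′
step-rank wait  = z≤n
step-rank enter = z≤n
step-rank stay  = s≤s z≤n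
step-rank leave = s≤s z≤n
step-rank done  = s≤s (s≤s z≤n)

run-rank : Run σ bs σ′ → rank σ ≤ rank σ′
run-rank []       = ≤-refl
run-rank (st ∷ r) = ≤-trans (step-rank st) (run-rank r)

run-++⁺ : Run σ bs μ → Run μ bs′ σ′ → Run σ (bs ++ bs′) σ′
run-++⁺ []       r = r
run-++⁺ (st ∷ q) r = st ∷ run-++⁺ q r

run-++⁻ : ∀ bs → Run σ (bs ++ bs′) σ′ → ∃ λ μ → Run σ bs μ × Run μ bs′ σ′
run-++⁻ []       r        = _ , [] , r
run-++⁻ (_ ∷ bs) (st ∷ r) with run-++⁻ bs r
... | μ , q , q′ = μ , st ∷ q , q′

before-run-Falses : Run before bs before → Falses bs
before-run-Falses []          = []
before-run-Falses (wait ∷ r)  = refl ∷ before-run-Falses r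
before-run-Falses (enter ∷ r) = case run-rank r of λ ()

inside-run-Trues : Run inside bs inside → Trues bs
inside-run-Trues []          = []
inside-run-Trues (stay ∷ r)  = refl ∷ inside-run-Trues r
inside-run-Trues (leave ∷ r) = case run-rank r of λ { (s≤s ()) }

after-run-Falses : Run after bs σ → Falses bs
after-run-Falses []         = []
after-run-Falses (done ∷ r) = refl ∷ after-run-Falses r

Falses⇒run-before : Falses bs → Run before bs before
Falses⇒run-before []          = []
Falses⇒run-before (refl ∷ fs) = wait ∷ Falses⇒run-before fs

Falses⇒run : Falses bs → ∀ σ → ∃ (Run σ bs)
Falses⇒run fs          before = _ , Falses⇒run-before fs
Falses⇒run []          σ      = σ , []
Falses⇒run (refl ∷ fs) inside = map₂ (leave ∷_) (Falses⇒run fs after)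
Falses⇒run (refl ∷ fs) after  = map₂ (done ∷_) (Falses⇒run fs after)

Trues⇒run-inside : Trues bs → Run inside bs inside
Trues⇒run-inside []          = []
Trues⇒run-inside (refl ∷ ts) = stay ∷ Trues⇒run-inside ts

Falses⇒¬Any-true : Falses bs → ¬ Any (_≡ true) bs
Falses⇒¬Any-true (refl ∷ _)  (here ())
Falses⇒¬Any-true (_ ∷ fs)    (there p) = Falses⇒¬Any-true fs p

lastBit : Phase → Bool
lastBit inside = true
lastBit _      = false

step-lastBit : Step σ b σ′ → b ≡ lastBit σ′
step-lastBit wait  = refl
step-lastBit enter = refl
step-lastBit stay  = refl
step-lastBit leave = refl
step-lastBit done  = refl

run-last : Run σ (b ∷ bs) σ′ → last (b ∷ bs) ≡ just (lastBit σ′)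
run-last (st ∷ [])       = cong just (step-lastBit st)
run-last (_ ∷ r@(_ ∷ _)) = run-last r

entered-run-Trues : Run before bs inside → head bs ≡ just true → Trues bs
entered-run-Trues (enter ∷ r) refl = refl ∷ inside-run-Trues r

private
  Blocks : List Bool → Set
  Blocks bs = ∃₂ λ us ws → ∃ λ zs → bs ≡ us ++ ws ++ zs × Falses us × Trues ws × Falses zs

  run⇒Blocks : Run before bs σ → Blocks bs
  run⇒Blocks []          = [] , [] , [] , refl , [] , [] , []
  run⇒Blocks (wait ∷ r) with run⇒Blocks r
  ... | us , ws , zs , refl , fu , tw , fz = false ∷ us , ws , zs , refl , refl ∷ fu , tw , fz
  run⇒Blocks (enter ∷ r) with inside⇒blocks r
    where
    inside⇒blocks : Run inside bs σ → ∃₂ λ ws zs → bs ≡ ws ++ zs × Trues ws × Falses zs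
    inside⇒blocks []          = [] , [] , refl , [] , []
    inside⇒blocks (stay ∷ r) with inside⇒blocks r
    ... | ws , zs , refl , tw , fz = true ∷ ws , zs , refl , refl ∷ tw , fz
    inside⇒blocks (leave ∷ r) = [] , _ , refl , [] , refl ∷ after-run-Falses r
  ... | ws , zs , refl , tw , fz = [] , true ∷ ws , zs , refl , [] , refl ∷ tw , fz

  Blocks⇒Convex : ∀ {us ws zs} → Falses us → Trues ws → Falses zs → Convex (us ++ ws ++ zs)
  Blocks⇒Convex fu []          fz = _ , run-++⁺ (Falses⇒run-before fu) (Falses⇒run-before fz)
  Blocks⇒Convex fu (refl ∷ tw) fz =
    map₂ (λ rz → run-++⁺ (Falses⇒run-before fu) (enter ∷ run-++⁺ (Trues⇒run-inside tw) rz))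
         (Falses⇒run fz inside)

  All-reverse : ∀ {P : Bool → Set} → All P bs → All P (reverse bs)
  All-reverse {bs} = All-resp-↭ (↭-sym (↭-reverse bs))

Convex-reverse : Convex bs → Convex (reverse bs)
Convex-reverse (_ , r) with run⇒Blocks r
... | us , ws , zs , refl , fu , tw , fz =
  subst Convex (sym reverse-blocks) (Blocks⇒Convex (All-reverse fz) (All-reverse tw) (All-reverse fu))
  where
  reverse-blocks : reverse (us ++ ws ++ zs) ≡ reverse zs ++ reverse ws ++ reverse us
  reverse-blocks = begin
    reverse (us ++ ws ++ zs)                ≡⟨ reverse-++ us (ws ++ zs) ⟩
    reverse (ws ++ zs) ++ reverse us        ≡⟨ cong (_++ reverse us) (reverse-++ ws zs) ⟩
    (reverse zs ++ reverse ws) ++ reverse us ≡⟨ ++-assoc (reverse zs) (reverse ws) (reverse us) ⟩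
    reverse zs ++ reverse ws ++ reverse us  ∎

Convex-pad : ∀ {us zs} → Falses us → Falses zs → Convex bs → Convex (us ++ bs ++ zs)
Convex-pad fu fz (_ , r) = map₂ (λ rz → run-++⁺ (Falses⇒run-before fu) (run-++⁺ r rz)) (Falses⇒run fz _)

constant-∷ʳ : All (_≡ b) bs → bs ∷ʳ b ≡ b ∷ bs
constant-∷ʳ []         = refl
constant-∷ʳ (refl ∷ a) = cong (_ ∷_) (constant-∷ʳ a)

reverse-constant : All (_≡ b) bs → reverse bs ≡ bs
reverse-constant []                       = refl
reverse-constant {bs = _ ∷ bs} (refl ∷ a) = begin
  reverse (_ ∷ bs) ≡⟨ unfold-reverse _ bs ⟩
  reverse bs ∷ʳ _  ≡⟨ cong (_∷ʳ _) (reverse-constant a) ⟩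
  bs ∷ʳ _          ≡⟨ constant-∷ʳ a ⟩
  _ ∷ bs           ∎

private
  module _ {xs ys zs : List Bool} where

    reverse-unchanged : ∀ {μ₁ μ₂} → Run before xs μ₁ → Run μ₁ ys μ₂ → Run μ₂ zs σ → reverse ys ≡ ys →
      Convex (xs ++ reverse ys ++ zs)
    reverse-unchanged rx ry rz eq =
      subst (λ ws → Convex (xs ++ ws ++ zs)) (sym eq) (_ , run-++⁺ rx (run-++⁺ ry rz))

    reverse-isolated : Falses xs → Falses zs → Run before ys σ → Convex (xs ++ reverse ys ++ zs)
    reverse-isolated fx fz ry = Convex-pad fx fz (Convex-reverse (_ , ry))

    reverse-middle-runs : ∀ {μ₁ μ₂} → Run before xs μ₁ → Run μ₁ ys μ₂ → Run μ₂ zs σ →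
      (last xs ≡ just true → head ys ≡ just true → last ys ≡ just true) →
      (head zs ≡ just true → last ys ≡ just true → head ys ≡ just true) →
      Convex (xs ++ reverse ys ++ zs)
    reverse-middle-runs {μ₁ = before} {before} rx ry rz _ _ =
      reverse-unchanged rx ry rz (reverse-constant (before-run-Falses ry))
    reverse-middle-runs {μ₁ = before} {inside} rx ry [] _ _ =
      reverse-isolated (before-run-Falses rx) [] ry
    reverse-middle-runs {μ₁ = before} {inside} rx ry (leave ∷ rz) _ _ =
      reverse-isolated (before-run-Falses rx) (refl ∷ after-run-Falses rz) ry
    reverse-middle-runs {μ₁ = before} {inside} rx ry@(_ ∷ _) rz@(stay ∷ _) _ hz =
      reverse-unchanged rx ry rz (reverse-constant (entered-run-Trues ry (hz refl (run-last ry))))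
    reverse-middle-runs {μ₁ = before} {after} rx ry rz _ _ =
      reverse-isolated (before-run-Falses rx) (after-run-Falses rz) ry
    reverse-middle-runs {μ₁ = inside} {inside} rx ry rz _ _ =
      reverse-unchanged rx ry rz (reverse-constant (inside-run-Trues ry))
    reverse-middle-runs {μ₁ = inside} {after} rx ry@(leave ∷ r) rz _ _ =
      reverse-unchanged rx ry rz (reverse-constant (refl ∷ after-run-Falses r))
    reverse-middle-runs {μ₁ = inside} {after} rx@(_ ∷ _) ry@(stay ∷ _) rz hx _
      with () ← trans (sym (hx (run-last rx) refl)) (run-last ry)
    reverse-middle-runs {μ₁ = after} {after} rx ry rz _ _ =
      reverse-unchanged rx ry rz (reverse-constant (after-run-Falses ry))
    reverse-middle-runs {μ₁ = inside} {before} rx ry rz _ _ = case run-rank ry of λ ()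
    reverse-middle-runs {μ₁ = after}  {before} rx ry rz _ _ = case run-rank ry of λ ()
    reverse-middle-runs {μ₁ = after}  {inside} rx ry rz _ _ = case run-rank ry of λ { (s≤s ()) }

Convex-reverse-middle : ∀ xs ys zs → Convex (xs ++ ys ++ zs) →
  (last xs ≡ just true → head ys ≡ just true → last ys ≡ just true) →
  (head zs ≡ just true → last ys ≡ just true → head ys ≡ just true) →
  Convex (xs ++ reverse ys ++ zs)
Convex-reverse-middle xs ys zs (_ , r) with run-++⁻ xs r
... | _ , rx , r′ with run-++⁻ ys r′
... | _ , ry , rz = reverse-middle-runs rx ry rz

Convex-between : ∀ xs ys zs → Convex (xs ++ ys ++ zs) → Any (_≡ true) xs → Any (_≡ true) zs → Trues ys
Convex-between xs ys zs (_ , r) ax az with run-++⁻ xs r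
... | _ , rx , r′ with run-++⁻ ys r′
... | _ , ry , rz = go rx ry rz
  where
  go : ∀ {μ₁ μ₂} → Run before xs μ₁ → Run μ₁ ys μ₂ → Run μ₂ zs σ → Trues ys
  go {μ₁ = before}              rx ry rz = ⊥-elim (Falses⇒¬Any-true (before-run-Falses rx) ax)
  go {μ₂ = after}               rx ry rz = ⊥-elim (Falses⇒¬Any-true (after-run-Falses rz) az)
  go {μ₁ = inside} {μ₂ = inside} rx ry rz = inside-run-Trues ry
  go {μ₁ = inside} {μ₂ = before} rx ry rz = case run-rank ry of λ ()
  go {μ₁ = after}  {μ₂ = before} rx ry rz = case run-rank ry of λ ()
  go {μ₁ = after}  {μ₂ = inside} rx ry rz = case run-rank ry of λ { (s≤s ()) }

bitAt : List Bool → ℕ → Bool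
bitAt []       _       = false
bitAt (b ∷ bs) zero    = b
bitAt (b ∷ bs) (suc i) = bitAt bs i

Gapless : List Bool → Set
Gapless bs = ∀ i j k → i ≤ j → j ≤ k → bitAt bs i ≡ true → bitAt bs k ≡ true → bitAt bs j ≡ true

Falses⇒bitAt : Falses bs → ∀ i → bitAt bs i ≡ false
Falses⇒bitAt []         _       = refl
Falses⇒bitAt (refl ∷ _) zero    = refl
Falses⇒bitAt (_ ∷ fs)   (suc i) = Falses⇒bitAt fs i

bitAt⇒Falses : (∀ i → bitAt bs i ≢ true) → Falses bs
bitAt⇒Falses {[]}         _ = []
bitAt⇒Falses {false ∷ bs} h = refl ∷ bitAt⇒Falses (h ∘ suc)
bitAt⇒Falses {true ∷ bs}  h = ⊥-elim (h zero refl)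

private
  true≢false : true ≢ false
  true≢false ()

  Falses-Gapless : Falses bs → Gapless bs
  Falses-Gapless fs i _ _ _ _ e _ = ⊥-elim (true≢false (trans (sym e) (Falses⇒bitAt fs i)))

  true∷Falses-Gapless : Falses bs → Gapless (true ∷ bs)
  true∷Falses-Gapless fs _ zero    _       _ _ _ _ = refl
  true∷Falses-Gapless fs _ (suc j) (suc k) _ _ _ e = ⊥-elim (true≢false (trans (sym e) (Falses⇒bitAt fs k)))

  false∷-Gapless : Gapless bs → Gapless (false ∷ bs)
  false∷-Gapless g (suc i) (suc j) (suc k) (s≤s p) (s≤s q) e e′ = g i j k p q e e′

  true∷true∷-Gapless : Gapless (true ∷ bs) → Gapless (true ∷ true ∷ bs)
  true∷true∷-Gapless g _ zero          _             _ _       _ _ = refl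
  true∷true∷-Gapless g _ (suc zero)    _             _ _       _ _ = refl
  true∷true∷-Gapless g _ (suc (suc j)) (suc (suc k)) _ (s≤s q) _ e = g 0 (suc j) (suc k) z≤n q refl e

  Gapless-tail : Gapless (b ∷ bs) → Gapless bs
  Gapless-tail g i j k p q = g (suc i) (suc j) (suc k) (s≤s p) (s≤s q)

  GaplessFrom : Phase → List Bool → Set
  GaplessFrom before bs = Gapless bs
  GaplessFrom inside bs = Gapless (true ∷ bs)
  GaplessFrom after  bs = Falses bs

  run-GaplessFrom : Run σ bs σ′ → GaplessFrom σ bs
  run-GaplessFrom {before} [] = Falses-Gapless []
  run-GaplessFrom {inside} [] = true∷Falses-Gapless []
  run-GaplessFrom {after}  [] = []
  run-GaplessFrom (wait  ∷ r) = false∷-Gapless (run-GaplessFrom r)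
  run-GaplessFrom (enter ∷ r) = run-GaplessFrom r
  run-GaplessFrom (stay  ∷ r) = true∷true∷-Gapless (run-GaplessFrom r)
  run-GaplessFrom (leave ∷ r) = true∷Falses-Gapless (refl ∷ run-GaplessFrom r)
  run-GaplessFrom (done  ∷ r) = refl ∷ run-GaplessFrom r

Convex⇒Gapless : Convex bs → Gapless bs
Convex⇒Gapless (_ , r) = run-GaplessFrom r

Gapless⇒Convex : ∀ bs → Gapless bs → Convex bs
Gapless⇒Convex []           g = _ , []
Gapless⇒Convex (false ∷ bs) g = map₂ (wait ∷_) (Gapless⇒Convex bs (Gapless-tail g))
Gapless⇒Convex (true ∷ bs)  g = map₂ (enter ∷_) (from-inside bs g)
  where
  from-inside : ∀ bs → Gapless (true ∷ bs) → ∃ (Run inside bs)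
  from-inside []           g = _ , []
  from-inside (true ∷ bs)  g = map₂ (stay ∷_) (from-inside bs (Gapless-tail g))
  from-inside (false ∷ bs) g = map₂ (leave ∷_) (Falses⇒run (bitAt⇒Falses no-true) after)
    where
    no-true : ∀ i → bitAt bs i ≢ true
    no-true i e = true≢false (sym (g 0 1 (suc (suc i)) z≤n (s≤s z≤n) refl e))

module _ {A : Set} where

  data Before (x y : A) : List A → Set where
    first : ∀ {zs} → y ∈ₗ zs → Before x y (x ∷ zs)
    later : ∀ {z zs} → Before x y zs → Before x y (z ∷ zs)

  private variable
    x y z : A
    us ws : List A

  Before-∈ : Before x y us → y ∈ₗ us
  Before-∈ (first m) = there m
  Before-∈ (later b) = there (Before-∈ b)

  Before-++ : x ∈ₗ us → y ∈ₗ ws → Before x y (us ++ ws)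
  Before-++ {us = _ ∷ us} (here refl) m = first (∈-++⁺ʳ us m)
  Before-++ (there m′) m = later (Before-++ m′ m)

  Before-++ˡ : Before x y us → Before x y (us ++ ws)
  Before-++ˡ (first m) = first (∈-++⁺ˡ m)
  Before-++ˡ (later b) = later (Before-++ˡ b)

  Before-++ʳ : ∀ us → Before x y ws → Before x y (us ++ ws)
  Before-++ʳ []       b = b
  Before-++ʳ (_ ∷ us) b = later (Before-++ʳ us b)

  Before-reverse : Before x y us → Before y x (reverse us)
  Before-reverse (first {zs} m) =
    subst (Before _ _) (sym (unfold-reverse _ zs)) (Before-++ (Any.reverse⁺ m) (here refl))
  Before-reverse (later {z} {zs} b) =
    subst (Before _ _) (sym (unfold-reverse z zs)) (Before-++ˡ (Before-reverse b))

  Before-asym : Unique us → Before x y us → Before y x us → ⊥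
  Before-asym (x∉ ∷ _) (first m) (first _)  = All¬⇒¬Any x∉ m
  Before-asym (x∉ ∷ _) (first _) (later b)  = All¬⇒¬Any x∉ (Before-∈ b)
  Before-asym (y∉ ∷ _) (later b) (first _)  = All¬⇒¬Any y∉ (Before-∈ b)
  Before-asym (_ ∷ u)  (later b) (later b′) = Before-asym u b b′

  Between : A → A → A → List A → Set
  Between x y z us = (Before x y us × Before y z us) ⊎ (Before z y us × Before y x us)

module _ {A B : Set} (f : A → B) where

  Before-map : ∀ {x y us} → Before x y us → Before (f x) (f y) (map f us)
  Before-map (first m) = first (∈-map⁺ f m)
  Before-map (later b) = later (Before-map b)

  Between-infix : ∀ {x y z} us {ws} vs → Between x y z ws → Between (f x) (f y) (f z) (us ++ map f ws ++ vs)
  Between-infix us {ws} vs = Sum.map (Product.map lift lift) (Product.map lift lift)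
    where
    lift : ∀ {a b} → Before a b ws → Before (f a) (f b) (us ++ map f ws ++ vs)
    lift b = Before-++ʳ us (Before-++ˡ (Before-map b))

map-++₃ : ∀ {A B : Set} (f : A → B) xs ys zs → map f (xs ++ ys ++ zs) ≡ map f xs ++ map f ys ++ map f zs
map-++₃ f xs ys zs = trans (map-++ f xs (ys ++ zs)) (cong (map f xs ++_) (map-++ f ys zs))

module _ {A : Set} where

  last-∷ʳ : ∀ (xs : List A) x → last (xs ∷ʳ x) ≡ just x
  last-∷ʳ []           x = refl
  last-∷ʳ (_ ∷ [])     x = refl
  last-∷ʳ (_ ∷ y ∷ xs) x = last-∷ʳ (y ∷ xs) x

  last-++ : ∀ (xs : List A) {ys y} → last ys ≡ just y → last (xs ++ ys) ≡ just y
  last-++ []                   eq = eq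
  last-++ (_ ∷ [])     {_ ∷ _} eq = eq
  last-++ (_ ∷ x ∷ xs)         eq = last-++ (x ∷ xs) eq

  head-++ : ∀ {xs ys : List A} {x} → head xs ≡ just x → head (xs ++ ys) ≡ just x
  head-++ {_ ∷ _} eq = eq

  last-∈ : ∀ {xs : List A} {x} → last xs ≡ just x → x ∈ₗ xs
  last-∈ {_ ∷ []}    refl = here refl
  last-∈ {_ ∷ _ ∷ _} eq   = there (last-∈ eq)

  ∈⇒∷ : ∀ {x : A} {xs} → x ∈ₗ xs → ∃₂ λ y ys → xs ≡ y ∷ ys
  ∈⇒∷ {xs = y ∷ ys} _ = y , ys , refl

  ∈⇒∷ʳ : ∀ {x : A} {xs} → x ∈ₗ xs → ∃₂ λ ys y → xs ≡ ys ∷ʳ y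
  ∈⇒∷ʳ {xs = xs} x∈ with initLast xs
  ∈⇒∷ʳ () | []
  ∈⇒∷ʳ _  | ys ∷ʳ′ y = ys , y , refl

  []-or-∷ : (xs : List A) → xs ≡ [] ⊎ ∃₂ λ y ys → xs ≡ y ∷ ys
  []-or-∷ []       = inj₁ refl
  []-or-∷ (y ∷ ys) = inj₂ (y , ys , refl)

  ++-regroup : ∀ (a b c d e : List A) → a ++ (b ++ c ++ d) ++ e ≡ (a ++ b) ++ c ++ (d ++ e)
  ++-regroup a b c d e = begin
    a ++ (b ++ c ++ d) ++ e ≡⟨ cong (a ++_) (++-assoc b (c ++ d) e) ⟩
    a ++ b ++ (c ++ d) ++ e ≡⟨ cong (λ l → a ++ b ++ l) (++-assoc c d e) ⟩
    a ++ b ++ c ++ d ++ e   ≡⟨ sym (++-assoc a b _) ⟩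
    (a ++ b) ++ c ++ d ++ e ∎

  map-nest : ∀ (f g h : A → A) → (∀ x → f (g x) ≡ h x) → ∀ A₂ A₁ X B₁ B₂ →
    A₂ ++ map f (A₁ ++ map g X ++ B₁) ++ B₂ ≡ (A₂ ++ map f A₁) ++ map h X ++ (map f B₁ ++ B₂)
  map-nest f g h fg≡h A₂ A₁ X B₁ B₂ = begin
    A₂ ++ map f (A₁ ++ map g X ++ B₁) ++ B₂
      ≡⟨ cong (λ l → A₂ ++ l ++ B₂) (map-++₃ f A₁ (map g X) B₁) ⟩
    A₂ ++ (map f A₁ ++ map f (map g X) ++ map f B₁) ++ B₂
      ≡⟨ cong (λ l → A₂ ++ (map f A₁ ++ l ++ map f B₁) ++ B₂) (trans (sym (map-∘ X)) (map-cong fg≡h X)) ⟩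
    A₂ ++ (map f A₁ ++ map h X ++ map f B₁) ++ B₂
      ≡⟨ ++-regroup A₂ (map f A₁) (map h X) (map f B₁) B₂ ⟩
    (A₂ ++ map f A₁) ++ map h X ++ (map f B₁ ++ B₂)
      ∎

-- Fronts and contexts of subtrees

private variable
  n : ℕ
  v : Fin n
  s c : Subset n
  t u T : Tree n
  ts : List (Tree n)
  ss xs ys : List (Subset n × Tree n)
  L : List (Subset n)

leavesQ-++ : (xs ys : List (Subset n × Tree n)) → leavesQ (xs ++ ys) ≡ leavesQ xs ++ leavesQ ys
leavesQ-++ []             ys = refl
leavesQ-++ ((s , t) ∷ xs) ys = trans (cong (map (s ∪_) (leaves t) ++_) (leavesQ-++ xs ys))
                                     (sym (++-assoc (map (s ∪_) (leaves t)) (leavesQ xs) (leavesQ ys)))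

leavesL-++ : (ts ts′ : List (Tree n)) → leavesL (ts ++ ts′) ≡ leavesL ts ++ leavesL ts′
leavesL-++ []       ts′ = refl
leavesL-++ (t ∷ ts) ts′ = trans (cong (leaves t ++_) (leavesL-++ ts ts′))
                                 (sym (++-assoc (leaves t) (leavesL ts) (leavesL ts′)))

mutual
  front-leaves : (t : Tree n) → Front t (leaves t)
  front-leaves (P s [])       = leafF
  front-leaves (P s (t ∷ ts)) = pF ↭-refl (frontL-leaves (t ∷ ts))
  front-leaves (Q ss)         = qF (frontQ-leaves ss)

  frontL-leaves : (ts : List (Tree n)) → FrontL ts (leavesL ts)
  frontL-leaves []       = []F
  frontL-leaves (t ∷ ts) = front-leaves t ∷F frontL-leaves ts

  frontQ-leaves : (ss : List (Subset n × Tree n)) → FrontQ ss (leavesQ ss)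
  frontQ-leaves []             = []F
  frontQ-leaves ((s , t) ∷ ss) = front-leaves t ∷F frontQ-leaves ss

frontL-++ : ∀ {ts ts′ : List (Tree n)} {L L′} → FrontL ts L → FrontL ts′ L′ → FrontL (ts ++ ts′) (L ++ L′)
frontL-++ []F g = g
frontL-++ {L′ = L′} (_∷F_ {L = L₁} {M = M} f fs) g =
  subst (FrontL _) (sym (++-assoc L₁ M L′)) (f ∷F frontL-++ fs g)

frontQ-++ : ∀ {L L′} → FrontQ xs L → FrontQ ys L′ → FrontQ (xs ++ ys) (L ++ L′)
frontQ-++ []F g = g
frontQ-++ {L′ = L′} (_∷F_ {s = s} {L = L₁} {M = M} f fs) g =
  subst (FrontQ _) (sym (++-assoc (map (s ∪_) L₁) M L′)) (f ∷F frontQ-++ fs g)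

frontQ-++⁻ : ∀ xs → FrontQ (xs ++ ys) L → ∃₂ λ L₁ L₂ → L ≡ L₁ ++ L₂ × FrontQ xs L₁ × FrontQ ys L₂
frontQ-++⁻ []       f = [] , _ , refl , []F , f
frontQ-++⁻ (_ ∷ xs) (_∷F_ {s = s} {L = L₁} f fs) with frontQ-++⁻ xs fs
... | M₁ , M₂ , refl , g , h = map (s ∪_) L₁ ++ M₁ , M₂ , sym (++-assoc (map (s ∪_) L₁) M₁ M₂) , f ∷F g , h

FrontBlock : Tree n → Subset n → List (Subset n) → Set
FrontBlock t U L = ∃₂ λ L₁ L₂ → ∃ λ L′ → L ≡ L₁ ++ map (U ∪_) L′ ++ L₂ × Front t L′

frontL-∈ : t ∈ₗ ts → FrontL ts L → ∃₂ λ L₁ L₂ → ∃ λ Lt → L ≡ L₁ ++ Lt ++ L₂ × Front t Lt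
frontL-∈ (here refl) (_∷F_ {L = Lt} {M = M} f _) = [] , M , Lt , refl , f
frontL-∈ (there m) (_∷F_ {L = L₀} f fs) with frontL-∈ m fs
... | L₁ , L₂ , Lt , refl , g = L₀ ++ L₁ , L₂ , Lt , sym (++-assoc L₀ L₁ _) , g

frontQ-∈ : (s , t) ∈ₗ ss → FrontQ ss L → FrontBlock t s L
frontQ-∈ (here refl) (_∷F_ {L = Lt} {M = M} f _) = [] , M , Lt , refl , f
frontQ-∈ (there m) (_∷F_ {s = s₀} {L = L₀} f fs) with frontQ-∈ m fs
... | L₁ , L₂ , Lt , refl , g = map (s₀ ∪_) L₀ ++ L₁ , L₂ , Lt , sym (++-assoc (map (s₀ ∪_) L₀) L₁ _) , g

leavesL-↭ : ∀ {ts ts′ : List (Tree n)} → ts ↭ ts′ → leavesL ts ↭ leavesL ts′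
leavesL-↭ ↭.refl         = ↭-refl
leavesL-↭ (↭.prep t p)   = ++⁺ˡ (leaves t) (leavesL-↭ p)
leavesL-↭ (↭.swap t u p) =
  ↭-trans (shifts (leaves t) (leaves u)) (++⁺ˡ (leaves u) (++⁺ˡ (leaves t) (leavesL-↭ p)))
leavesL-↭ (↭.trans p q)  = ↭-trans (leavesL-↭ p) (leavesL-↭ q)

leavesQ-reverse-↭ : (ss : List (Subset n × Tree n)) → leavesQ (reverse ss) ↭ leavesQ ss
leavesQ-reverse-↭ []             = ↭-refl
leavesQ-reverse-↭ ((s , t) ∷ ss) =
  ↭-trans (↭-reflexive snoc) (↭-trans (++-comm (leavesQ (reverse ss)) St) (++⁺ˡ St (leavesQ-reverse-↭ ss)))
  where
  St = map (s ∪_) (leaves t)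
  snoc : leavesQ (reverse ((s , t) ∷ ss)) ≡ leavesQ (reverse ss) ++ St
  snoc = begin
    leavesQ (reverse ((s , t) ∷ ss))           ≡⟨ cong leavesQ (unfold-reverse (s , t) ss) ⟩
    leavesQ (reverse ss ++ (s , t) ∷ [])       ≡⟨ leavesQ-++ (reverse ss) _ ⟩
    leavesQ (reverse ss) ++ St ++ []           ≡⟨ cong (leavesQ (reverse ss) ++_) (++-identityʳ St) ⟩
    leavesQ (reverse ss) ++ St                 ∎

mutual
  front-↭ : Front t L → L ↭ leaves t
  front-↭ leafF                = ↭-refl
  front-↭ (pF {s = s} p fs)    = map⁺ (s ∪_) (↭-trans (frontL-↭ fs) (leavesL-↭ p))
  front-↭ (qF fs)              = frontQ-↭ fs
  front-↭ (qRevF {ss = ss} fs) = ↭-trans (frontQ-↭ fs) (leavesQ-reverse-↭ ss)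

  frontL-↭ : FrontL ts L → L ↭ leavesL ts
  frontL-↭ []F       = ↭-refl
  frontL-↭ (f ∷F fs) = ++⁺ (front-↭ f) (frontL-↭ fs)

  frontQ-↭ : FrontQ ss L → L ↭ leavesQ ss
  frontQ-↭ []F                   = ↭-refl
  frontQ-↭ (_∷F_ {s = s} f fs) = ++⁺ (map⁺ (s ∪_) (front-↭ f)) (frontQ-↭ fs)

frontQ-leaf : FrontQ ss L → (s , t) ∈ₗ ss → c ∈ₗ leaves t → (s ∪ c) ∈ₗ L
frontQ-leaf f m c∈ with frontQ-∈ m f
... | L₁ , L₂ , Lt , refl , g = ∈-++⁺ʳ L₁ (∈-++⁺ˡ (∈-map⁺ _ (∈-resp-↭ (↭-sym (front-↭ g)) c∈)))

frontQ-Before : ∀ {s₁ t₁ s₂ t₂ c₁ c₂} xs → FrontQ (xs ++ ys) L → (s₁ , t₁) ∈ₗ xs → (s₂ , t₂) ∈ₗ ys →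
  c₁ ∈ₗ leaves t₁ → c₂ ∈ₗ leaves t₂ → Before (s₁ ∪ c₁) (s₂ ∪ c₂) L
frontQ-Before xs f m₁ m₂ c₁∈ c₂∈ with frontQ-++⁻ xs f
... | L₁ , L₂ , refl , f₁ , f₂ = Before-++ (frontQ-leaf f₁ m₁ c₁∈) (frontQ-leaf f₂ m₂ c₂∈)

-- The children of a Q-node are either all in order or all in reverse order.
Q-Between : ∀ {s₁ t₁ s₂ t₂ s₃ t₃ c₁ c₂ c₃} K₁ K₂ K₃ → Front (Q (K₁ ++ K₂ ++ K₃)) L →
  (s₁ , t₁) ∈ₗ K₁ → (s₂ , t₂) ∈ₗ K₂ → (s₃ , t₃) ∈ₗ K₃ →
  c₁ ∈ₗ leaves t₁ → c₂ ∈ₗ leaves t₂ → c₃ ∈ₗ leaves t₃ → Between (s₁ ∪ c₁) (s₂ ∪ c₂) (s₃ ∪ c₃) L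
Q-Between K₁ K₂ K₃ (qF f) m₁ m₂ m₃ c₁ c₂ c₃ =
  inj₁ ( frontQ-Before K₁ f m₁ (∈-++⁺ˡ m₂) c₁ c₂
       , frontQ-Before (K₁ ++ K₂) (subst (λ ks → FrontQ ks _) (sym (++-assoc K₁ K₂ K₃)) f)
           (∈-++⁺ʳ K₁ m₂) m₃ c₂ c₃ )
Q-Between K₁ K₂ K₃ (qRevF f) m₁ m₂ m₃ c₁ c₂ c₃ =
  inj₂ ( frontQ-Before (reverse K₃) (subst (λ ks → FrontQ ks _) rev₁ f)
           (Any.reverse⁺ m₃) (∈-++⁺ˡ (Any.reverse⁺ m₂)) c₃ c₂
       , frontQ-Before (reverse K₃ ++ reverse K₂) (subst (λ ks → FrontQ ks _) rev₂ f)
           (∈-++⁺ʳ (reverse K₃) (Any.reverse⁺ m₂)) (Any.reverse⁺ m₁) c₂ c₁ )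
  where
  rev₂ : reverse (K₁ ++ K₂ ++ K₃) ≡ (reverse K₃ ++ reverse K₂) ++ reverse K₁
  rev₂ = trans (reverse-++ K₁ (K₂ ++ K₃)) (cong (_++ reverse K₁) (reverse-++ K₂ K₃))
  rev₁ : reverse (K₁ ++ K₂ ++ K₃) ≡ reverse K₃ ++ reverse K₂ ++ reverse K₁
  rev₁ = trans rev₂ (++-assoc (reverse K₃) (reverse K₂) (reverse K₁))

-- `above` collects the sets of the nodes strictly above t (for a Q-node, the section on the path)
record Context (t T : Tree n) : Set where
  field
    above        : Subset n
    left right   : List (Subset n)
    leaves-split : leaves T ≡ left ++ map (above ∪_) (leaves t) ++ right
    extend       : Front t L → Front T (left ++ map (above ∪_) L ++ right)
    restrict     : Front T L → FrontBlock t above L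

context-refl : Context T T
context-refl {T = T} = record
  { above        = ∅
  ; left         = []
  ; right        = []
  ; leaves-split = sym (unit (leaves T))
  ; extend       = λ {L} f → subst (Front T) (sym (unit L)) f
  ; restrict     = λ {L} f → [] , [] , L , sym (unit L) , f
  }
  where
  unit : ∀ L → map (∅ ∪_) L ++ [] ≡ L
  unit L = trans (++-identityʳ _) (trans (map-cong ∪-identityˡ L) (map-id L))

context-trans : Context t u → Context u T → Context t T
context-trans {t = t} c d = record
  { above        = D.above ∪ C.above
  ; left         = D.left ++ map (D.above ∪_) C.left
  ; right        = map (D.above ∪_) C.right ++ D.right
  ; leaves-split = trans D.leaves-split
                      (trans (cong (λ l → D.left ++ map (D.above ∪_) l ++ D.right) C.leaves-split) (nest (leaves t)))
  ; extend       = λ f → subst (Front _) (nest _) (D.extend (C.extend f))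
  ; restrict     = restrict
  }
  where
  module C = Context c
  module D = Context d
  nest : ∀ X → D.left ++ map (D.above ∪_) (C.left ++ map (C.above ∪_) X ++ C.right) ++ D.right ≡
               (D.left ++ map (D.above ∪_) C.left) ++ map ((D.above ∪ C.above) ∪_) X ++
               (map (D.above ∪_) C.right ++ D.right)
  nest X = map-nest _ _ _ (λ x → sym (∪-assoc D.above C.above x)) D.left C.left X C.right D.right
  restrict : Front _ L → FrontBlock t (D.above ∪ C.above) L
  restrict f with D.restrict f
  ... | L₁ , L₂ , L′ , refl , g with C.restrict g
  ... | M₁ , M₂ , M′ , refl , h = L₁ ++ map (D.above ∪_) M₁ , map (D.above ∪_) M₂ ++ L₂ , M′ ,
                                  map-nest _ _ _ (λ x → sym (∪-assoc D.above C.above x)) L₁ M₁ M′ M₂ L₂ , h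

private
  leaves-P : ∀ ts₁ {ts₂} → leaves (P s (ts₁ ++ t ∷ ts₂)) ≡ map (s ∪_) (leavesL (ts₁ ++ t ∷ ts₂))
  leaves-P []      = refl
  leaves-P (_ ∷ _) = refl

  front-P : ∀ ts₁ {ts₂} → FrontL (ts₁ ++ t ∷ ts₂) L → Front (P s (ts₁ ++ t ∷ ts₂)) (map (s ∪_) L)
  front-P []      = pF ↭-refl
  front-P (_ ∷ _) = pF ↭-refl

  restrictP : t ∈ₗ ts → Front (P s ts) L → FrontBlock t s L
  restrictP {s = s} m (pF p fs) with frontL-∈ (∈-resp-↭ (↭-sym p) m) fs
  ... | L₁ , L₂ , Lt , refl , f = map (s ∪_) L₁ , map (s ∪_) L₂ , Lt , map-++₃ (s ∪_) L₁ Lt L₂ , f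

  restrictQ : (s , t) ∈ₗ ss → Front (Q ss) L → FrontBlock t s L
  restrictQ m (qF f)    = frontQ-∈ m f
  restrictQ m (qRevF f) = frontQ-∈ (Any.reverse⁺ m) f

context-P : t ∈ₗ ts → Context t (P s ts)
context-P {t = t} {s = s} m with ∈-∃++ m
... | ts₁ , ts₂ , refl = record
  { above        = s
  ; left         = map (s ∪_) (leavesL ts₁)
  ; right        = map (s ∪_) (leavesL ts₂)
  ; leaves-split = trans (leaves-P ts₁) (trans (cong (map (s ∪_)) (leavesL-++ ts₁ (t ∷ ts₂)))
                                                      (map-++₃ (s ∪_) (leavesL ts₁) (leaves t) (leavesL ts₂)))
  ; extend       = λ {L} f → subst (Front _) (map-++₃ (s ∪_) (leavesL ts₁) L (leavesL ts₂))
                           (front-P ts₁ (frontL-++ (frontL-leaves ts₁) (f ∷F frontL-leaves ts₂)))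
  ; restrict     = restrictP m
  }

context-Q : (s , t) ∈ₗ ss → Context t (Q ss)
context-Q {s = s} {t = t} m with ∈-∃++ m
... | ss₁ , ss₂ , refl = record
  { above        = s
  ; left         = leavesQ ss₁
  ; right        = leavesQ ss₂
  ; leaves-split = leavesQ-++ ss₁ ((s , t) ∷ ss₂)
  ; extend       = λ f → qF (frontQ-++ (frontQ-leaves ss₁) (f ∷F frontQ-leaves ss₂))
  ; restrict     = restrictQ m
  }

mutual
  context : t ∈ₗ subtrees T → Context t T
  context {T = P s ts} (here refl) = context-refl
  context {T = P s ts} (there m) with contextL ts m
  ... | u , u∈ , c = context-trans c (context-P u∈)
  context {T = Q ss}   (here refl) = context-refl
  context {T = Q ss}   (there m) with contextQ ss m
  ... | s , u , u∈ , c = context-trans c (context-Q u∈)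

  contextL : ∀ ts → t ∈ₗ subtreesL ts → ∃ λ u → u ∈ₗ ts × Context t u
  contextL (u ∷ ts) m with ∈-++⁻ (subtrees u) m
  ... | inj₁ m′ = u , here refl , context m′
  ... | inj₂ m′ with contextL ts m′
  ...   | u′ , u′∈ , c = u′ , there u′∈ , c

  contextQ : ∀ ss → t ∈ₗ subtreesQ ss → ∃₂ λ s u → (s , u) ∈ₗ ss × Context t u
  contextQ ((s , u) ∷ ss) m with ∈-++⁻ (subtrees u) m
  ... | inj₁ m′ = s , u , here refl , context m′
  ... | inj₂ m′ with contextQ ss m′
  ...   | s′ , u′ , u′∈ , c = s′ , u′ , there u′∈ , c

Between-context : ∀ {x y z} (c : Context t T) → (∀ {L} → Front t L → Between x y z L) →
  ∀ {L} → Front T L → Between (Context.above c ∪ x) (Context.above c ∪ y) (Context.above c ∪ z) L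
Between-context c between-t f with Context.restrict c f
... | L₁ , L₂ , L′ , refl , g = Between-infix (_ ∪_) L₁ L₂ (between-t g)

leaf-exists : (∀ {ss} → Q ss ∈ₗ subtrees t → ss ≢ []) → ∃ λ c → c ∈ₗ leaves t
leaf-exists {t = P s []}             _ = s , here refl
leaf-exists {t = P s (t ∷ ts)}       h with leaf-exists {t = t} (h ∘ there ∘ ∈-++⁺ˡ)
... | c , c∈ = s ∪ c , ∈-map⁺ (s ∪_) (∈-++⁺ˡ c∈)
leaf-exists {t = Q []}               h = ⊥-elim (h (here refl) refl)
leaf-exists {t = Q ((s , t) ∷ ss)}   h with leaf-exists {t = t} (h ∘ there ∘ ∈-++⁺ˡ)
... | c , c∈ = s ∪ c , ∈-++⁺ˡ (∈-map⁺ (s ∪_) c∈)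

QNondeg⇒nonempty : QNondeg ss → ss ≢ []
QNondeg⇒nonempty ((_ , v∈) , _) refl = ∉⊥ v∈

leavesQ-∈ : ∀ ss → (s , t) ∈ₗ ss → c ∈ₗ leaves t → (s ∪ c) ∈ₗ leavesQ ss
leavesQ-∈ ss = frontQ-leaf (frontQ-leaves ss)

head-leavesQ : ∀ (f : Subset n → Subset n) {cs} K → leaves t ≡ c ∷ cs →
  head (map f (leavesQ ((s , t) ∷ K))) ≡ just (f (s ∪ c))
head-leavesQ {t = t} {s = s} f K eq =
  trans (head-map {f = f} (leavesQ ((s , t) ∷ K))) (cong (Maybe.map f) (head-++ (cong (head ∘ map (s ∪_)) eq)))

last-leavesQ : ∀ (f : Subset n → Subset n) {cs} K → leaves t ≡ cs ∷ʳ c →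
  last (map f (leavesQ (K ∷ʳ (s , t)))) ≡ just (f (s ∪ c))
last-leavesQ {t = t} {c = c} {s = s} f {cs} K eq = begin
  last (map f (leavesQ (K ∷ʳ (s , t))))                       ≡⟨ last-map f (leavesQ (K ∷ʳ (s , t))) ⟩
  Maybe.map f (last (leavesQ (K ∷ʳ (s , t))))                 ≡⟨ cong (Maybe.map f ∘ last) (leavesQ-++ K _) ⟩
  Maybe.map f (last (leavesQ K ++ map (s ∪_) (leaves t) ++ []))
                                                              ≡⟨ cong (Maybe.map f) (last-++ (leavesQ K) last-t) ⟩
  just (f (s ∪ c))                                            ∎
  where
  last-t : last (map (s ∪_) (leaves t) ++ []) ≡ just (s ∪ c)
  last-t = begin
    last (map (s ∪_) (leaves t) ++ [])     ≡⟨ cong last (++-identityʳ (map (s ∪_) (leaves t))) ⟩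
    last (map (s ∪_) (leaves t))           ≡⟨ last-map (s ∪_) (leaves t) ⟩
    Maybe.map (s ∪_) (last (leaves t))     ≡⟨ cong (Maybe.map (s ∪_) ∘ last) eq ⟩
    Maybe.map (s ∪_) (last (cs ∷ʳ c))      ≡⟨ cong (Maybe.map (s ∪_)) (last-∷ʳ cs c) ⟩
    just (s ∪ c)                           ∎

-- Assignment of vertices to nodes

occ-++ : ∀ (v : Fin n) xs ys → occ v (xs ++ ys) ≡ occ v xs + occ v ys
occ-++ v []       ys = refl
occ-++ v (S ∷ xs) ys =
  trans (cong (_ +_) (occ-++ v xs ys)) (sym (+-assoc (if lookup S v then 1 else 0) (occ v xs) (occ v ys)))

occ-∷-∈ : ∀ {S} L → v ∈ S → occ v (S ∷ L) ≡ suc (occ v L)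
occ-∷-∈ {v = v} {S} L v∈S rewrite []=⇒lookup v∈S = refl

occ-∷-≥1 : ∀ {S} L → v ∈ S → 1 ≤ occ v (S ∷ L)
occ-∷-≥1 L v∈S rewrite occ-∷-∈ L v∈S = s≤s z≤n

occ-≤-∷ : ∀ S L → occ v L ≤ occ v (S ∷ L)
occ-≤-∷ _ _ = m≤n+m _ _

occ-≤-++ˡ : ∀ xs ys → occ v xs ≤ occ v (xs ++ ys)
occ-≤-++ˡ {v = v} xs ys = ≤-trans (m≤m+n _ _) (≤-reflexive (sym (occ-++ v xs ys)))

occ-≤-++ʳ : ∀ xs ys → occ v ys ≤ occ v (xs ++ ys)
occ-≤-++ʳ {v = v} xs ys = ≤-trans (m≤n+m _ _) (≤-reflexive (sym (occ-++ v xs ys)))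

nodeSetsQ-++ : (xs ys : List (Subset n × Tree n)) → nodeSetsQ (xs ++ ys) ≡ nodeSetsQ xs ++ nodeSetsQ ys
nodeSetsQ-++ []             ys = refl
nodeSetsQ-++ ((_ , t) ∷ xs) ys =
  trans (cong (nodeSets t ++_) (nodeSetsQ-++ xs ys)) (sym (++-assoc (nodeSets t) _ _))

subtrees-self : (t : Tree n) → t ∈ₗ subtrees t
subtrees-self (P _ _) = here refl
subtrees-self (Q _)   = here refl

child∈subtreesQ : (s , t) ∈ₗ ss → t ∈ₗ subtreesQ ss
child∈subtreesQ {t = t} (here refl)         = ∈-++⁺ˡ (subtrees-self t)
child∈subtreesQ {ss = (_ , u) ∷ _} (there m) = ∈-++⁺ʳ (subtrees u) (child∈subtreesQ m)

mutual
  subtree-trans : t ∈ₗ subtrees u → u ∈ₗ subtrees T → t ∈ₗ subtrees T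
  subtree-trans {T = P _ _}  t∈ (here refl) = t∈
  subtree-trans {T = Q _}    t∈ (here refl) = t∈
  subtree-trans {T = P _ ts} t∈ (there m) = there (subtree-transL ts t∈ m)
  subtree-trans {T = Q ss}   t∈ (there m) = there (subtree-transQ ss t∈ m)

  subtree-transL : ∀ ts → t ∈ₗ subtrees u → u ∈ₗ subtreesL ts → t ∈ₗ subtreesL ts
  subtree-transL (w ∷ ts) t∈ m with ∈-++⁻ (subtrees w) m
  ... | inj₁ m′ = ∈-++⁺ˡ (subtree-trans t∈ m′)
  ... | inj₂ m′ = ∈-++⁺ʳ (subtrees w) (subtree-transL ts t∈ m′)

  subtree-transQ : ∀ ss → t ∈ₗ subtrees u → u ∈ₗ subtreesQ ss → t ∈ₗ subtreesQ ss
  subtree-transQ ((_ , w) ∷ ss) t∈ m with ∈-++⁻ (subtrees w) m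
  ... | inj₁ m′ = ∈-++⁺ˡ (subtree-trans t∈ m′)
  ... | inj₂ m′ = ∈-++⁺ʳ (subtrees w) (subtree-transQ ss t∈ m′)

mutual
  occ-subtree : t ∈ₗ subtrees T → occ v (nodeSets t) ≤ occ v (nodeSets T)
  occ-subtree {T = P _ _} (here refl) = ≤-refl
  occ-subtree {T = Q _}   (here refl) = ≤-refl
  occ-subtree {T = P s ts} (there m) = ≤-trans (occ-subtreeL ts m) (occ-≤-∷ s (nodeSetsL ts))
  occ-subtree {T = Q ss}   (there m) = ≤-trans (occ-subtreeQ ss m) (occ-≤-∷ (secUnion ss) (nodeSetsQ ss))

  occ-subtreeL : ∀ ts → t ∈ₗ subtreesL ts → occ v (nodeSets t) ≤ occ v (nodeSetsL ts)
  occ-subtreeL (u ∷ ts) m with ∈-++⁻ (subtrees u) m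
  ... | inj₁ m′ = ≤-trans (occ-subtree m′) (occ-≤-++ˡ (nodeSets u) _)
  ... | inj₂ m′ = ≤-trans (occ-subtreeL ts m′) (occ-≤-++ʳ (nodeSets u) _)

  occ-subtreeQ : ∀ ss → t ∈ₗ subtreesQ ss → occ v (nodeSets t) ≤ occ v (nodeSetsQ ss)
  occ-subtreeQ ((_ , u) ∷ ss) m with ∈-++⁻ (subtrees u) m
  ... | inj₁ m′ = ≤-trans (occ-subtree m′) (occ-≤-++ˡ (nodeSets u) _)
  ... | inj₂ m′ = ≤-trans (occ-subtreeQ ss m′) (occ-≤-++ʳ (nodeSets u) _)

section⊆secUnion : (s , t) ∈ₗ ss → s ⊆ secUnion ss
section⊆secUnion (here refl) = p⊆p∪q _
section⊆secUnion {ss = (s′ , _) ∷ _} (there m) = q⊆p∪q s′ _ ∘ section⊆secUnion m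

mutual
  verts-occ : ∀ t → v ∈ verts t → 1 ≤ occ v (nodeSets t)
  verts-occ (P s ts) v∈ with x∈p∪q⁻ s (vertsL ts) v∈
  ... | inj₁ v∈s = occ-∷-≥1 (nodeSetsL ts) v∈s
  ... | inj₂ v∈ts = ≤-trans (verts-occL ts v∈ts) (occ-≤-∷ s (nodeSetsL ts))
  verts-occ (Q ss) v∈ with verts-occQ ss v∈
  ... | inj₁ v∈secs = occ-∷-≥1 (nodeSetsQ ss) v∈secs
  ... | inj₂ occ≥1  = ≤-trans occ≥1 (occ-≤-∷ (secUnion ss) (nodeSetsQ ss))

  verts-occL : ∀ ts → v ∈ vertsL ts → 1 ≤ occ v (nodeSetsL ts)
  verts-occL []       v∈ = ⊥-elim (∉⊥ v∈)
  verts-occL (t ∷ ts) v∈ with x∈p∪q⁻ (verts t) (vertsL ts) v∈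
  ... | inj₁ v∈t  = ≤-trans (verts-occ t v∈t) (occ-≤-++ˡ (nodeSets t) _)
  ... | inj₂ v∈ts = ≤-trans (verts-occL ts v∈ts) (occ-≤-++ʳ (nodeSets t) _)

  verts-occQ : ∀ ss → v ∈ vertsQ ss → v ∈ secUnion ss ⊎ 1 ≤ occ v (nodeSetsQ ss)
  verts-occQ [] v∈ = ⊥-elim (∉⊥ v∈)
  verts-occQ ((s , t) ∷ ss) v∈ with x∈p∪q⁻ s _ v∈
  ... | inj₁ v∈s = inj₁ (p⊆p∪q _ v∈s)
  ... | inj₂ v∈′ with x∈p∪q⁻ (verts t) (vertsQ ss) v∈′
  ...   | inj₁ v∈t = inj₂ (≤-trans (verts-occ t v∈t) (occ-≤-++ˡ (nodeSets t) _))
  ...   | inj₂ v∈ss with verts-occQ ss v∈ss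
  ...     | inj₁ v∈secs = inj₁ (q⊆p∪q s _ v∈secs)
  ...     | inj₂ occ≥1  = inj₂ (≤-trans occ≥1 (occ-≤-++ʳ (nodeSets t) _))

∪-monoʳ : ∀ (p : Subset n) {q r} → q ⊆ r → p ∪ q ⊆ p ∪ r
∪-monoʳ p q⊆r x∈ with x∈p∪q⁻ p _ x∈
... | inj₁ x∈p = x∈p∪q⁺ (inj₁ x∈p)
... | inj₂ x∈q = x∈p∪q⁺ (inj₂ (q⊆r x∈q))

Within : List (Subset n) → Subset n → Set
Within L V = ∀ {c} → c ∈ₗ L → c ⊆ V

private
  within-map : ∀ (s : Subset n) {L V} → Within L V → Within (map (s ∪_) L) (s ∪ V)
  within-map s w m with ∈-map⁻ (s ∪_) m
  ... | _ , m′ , refl = ∪-monoʳ s (w m′)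

  within-++ : ∀ {L₁ L₂} {V₁ V₂ : Subset n} → Within L₁ V₁ → Within L₂ V₂ → Within (L₁ ++ L₂) (V₁ ∪ V₂)
  within-++ {L₁ = L₁} {V₁ = V₁} w₁ w₂ m with ∈-++⁻ L₁ m
  ... | inj₁ m′ = p⊆p∪q _ ∘ w₁ m′
  ... | inj₂ m′ = q⊆p∪q V₁ _ ∘ w₂ m′

mutual
  leaf⊆verts : (t : Tree n) → Within (leaves t) (verts t)
  leaf⊆verts (P s [])       (here refl) = p⊆p∪q _
  leaf⊆verts (P s (t ∷ ts)) = within-map s (leaf⊆vertsL (t ∷ ts))
  leaf⊆verts (Q ss)         = leaf⊆vertsQ ss

  leaf⊆vertsL : (ts : List (Tree n)) → Within (leavesL ts) (vertsL ts)
  leaf⊆vertsL []       ()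
  leaf⊆vertsL (t ∷ ts) = within-++ (leaf⊆verts t) (leaf⊆vertsL ts)

  leaf⊆vertsQ : (ss : List (Subset n × Tree n)) → Within (leavesQ ss) (vertsQ ss)
  leaf⊆vertsQ []             ()
  leaf⊆vertsQ ((s , t) ∷ ss) m =
    ⊆-reflexive (∪-assoc s (verts t) (vertsQ ss)) ∘ within-++ (within-map s (leaf⊆verts t)) (leaf⊆vertsQ ss) m

private
  child-occ : (s , t) ∈ₗ ss → v ∈ verts t → 1 ≤ occ v (nodeSetsQ ss)
  child-occ {t = t} {ss = ss} m v∈ = ≤-trans (verts-occ t v∈) (occ-subtreeQ ss (child∈subtreesQ m))

  section-child-occ : ∀ {s₁ t₁ s₂ t₂} → (s₁ , t₁) ∈ₗ ss → (s₂ , t₂) ∈ₗ ss → v ∈ s₁ → v ∈ verts t₂ →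
    2 ≤ occ v (nodeSets (Q ss))
  section-child-occ {ss = ss} m₁ m₂ v∈s₁ v∈t₂
    rewrite occ-∷-∈ (nodeSetsQ ss) (section⊆secUnion m₁ v∈s₁) = s≤s (child-occ m₂ v∈t₂)

  children-occ : ∀ K₁ K₂ {s₁ t₁ s₂ t₂} → (s₁ , t₁) ∈ₗ K₁ → (s₂ , t₂) ∈ₗ K₂ → v ∈ verts t₁ → v ∈ verts t₂ →
    2 ≤ occ v (nodeSets (Q (K₁ ++ K₂)))
  children-occ {v = v} K₁ K₂ m₁ m₂ v∈t₁ v∈t₂ =
    ≤-trans (+-mono-≤ (child-occ m₁ v∈t₁) (child-occ m₂ v∈t₂))
            (≤-trans (≤-reflexive split) (occ-≤-∷ (secUnion (K₁ ++ K₂)) (nodeSetsQ (K₁ ++ K₂))))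
    where
    split : occ v (nodeSetsQ K₁) + occ v (nodeSetsQ K₂) ≡ occ v (nodeSetsQ (K₁ ++ K₂))
    split = trans (sym (occ-++ v (nodeSetsQ K₁) _)) (cong (occ v) (sym (nodeSetsQ-++ K₁ K₂)))

  2≰1 : ∀ {k} → 2 ≤ k → k ≤ 1 → ⊥
  2≰1 (s≤s (s≤s _)) (s≤s ())

Q-cliques-sections : ∀ K₁ K₂ {s₁ t₁ s₂ t₂ c₁ c₂} → occ v (nodeSets (Q (K₁ ++ K₂))) ≤ 1 →
  (s₁ , t₁) ∈ₗ K₁ → (s₂ , t₂) ∈ₗ K₂ → c₁ ∈ₗ leaves t₁ → c₂ ∈ₗ leaves t₂ →
  v ∈ s₁ ∪ c₁ → v ∈ s₂ ∪ c₂ → v ∈ s₁ × v ∈ s₂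
Q-cliques-sections K₁ K₂ {s₁ = s₁} {t₁} {s₂} {t₂} {c₁} {c₂} once m₁ m₂ c₁∈ c₂∈ v∈₁ v∈₂
  with x∈p∪q⁻ s₁ c₁ v∈₁ | x∈p∪q⁻ s₂ c₂ v∈₂
... | inj₁ v∈s₁ | inj₁ v∈s₂ = v∈s₁ , v∈s₂
... | inj₁ v∈s₁ | inj₂ v∈c₂ =
  ⊥-elim (2≰1 (section-child-occ (∈-++⁺ˡ m₁) (∈-++⁺ʳ K₁ m₂) v∈s₁ (leaf⊆verts t₂ c₂∈ v∈c₂)) once)
... | inj₂ v∈c₁ | inj₁ v∈s₂ =
  ⊥-elim (2≰1 (section-child-occ (∈-++⁺ʳ K₁ m₂) (∈-++⁺ˡ m₁) v∈s₂ (leaf⊆verts t₁ c₁∈ v∈c₁)) once)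
... | inj₂ v∈c₁ | inj₂ v∈c₂ =
  ⊥-elim (2≰1 (children-occ K₁ K₂ m₁ m₂ (leaf⊆verts t₁ c₁∈ v∈c₁) (leaf⊆verts t₂ c₂∈ v∈c₂)) once)

-- Incidence lists of vertices

incidence : Fin n → List (Subset n) → List Bool
incidence v = map (λ S → lookup S v)

bitAt-incidence : ∀ (v : Fin n) L i → bitAt (incidence v L) i ≡ lookup (at L i) v
bitAt-incidence v []      i       = sym (lookup-replicate v false)
bitAt-incidence v (S ∷ L) zero    = refl
bitAt-incidence v (S ∷ L) (suc i) = bitAt-incidence v L i

Consecutive⇒Convex : Consecutive L → ∀ v → Convex (incidence v L)
Consecutive⇒Convex {L = L} cons v = Gapless⇒Convex _ λ i j k i≤j j≤k vi vk →
  bit (cons v i j k i≤j j≤k (member i vi) (member k vk))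
  where
  bit : ∀ {i} → v ∈ at L i → bitAt (incidence v L) i ≡ true
  bit {i} v∈ = trans (bitAt-incidence v L i) ([]=⇒lookup v∈)
  member : ∀ i → bitAt (incidence v L) i ≡ true → v ∈ at L i
  member i b = lookup⇒[]= v (at L i) (trans (sym (bitAt-incidence v L i)) b)

Convex⇒Consecutive : (∀ v → Convex (incidence v L)) → Consecutive L
Convex⇒Consecutive {L = L} convex v i j k i≤j j≤k vi vk =
  lookup⇒[]= v (at L j) (trans (sym (bitAt-incidence v L j))
    (Convex⇒Gapless (convex v) i j k i≤j j≤k (bit i vi) (bit k vk)))
  where
  bit : ∀ i → v ∈ at L i → bitAt (incidence v L) i ≡ true
  bit i v∈ = trans (bitAt-incidence v L i) ([]=⇒lookup v∈)

incidence-Any : c ∈ₗ L → v ∈ c → Any (_≡ true) (incidence v L)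
incidence-Any (here refl) v∈ = here ([]=⇒lookup v∈)
incidence-Any (there m)   v∈ = there (incidence-Any m v∈)

incidence-All : Trues (incidence v L) → c ∈ₗ L → v ∈ c
incidence-All (t ∷ _)  (here refl) = lookup⇒[]= _ _ t
incidence-All (_ ∷ ts) (there m)   = incidence-All ts m

private
  incidence-head : head L ≡ just c → head (incidence v L) ≡ just (lookup c v)
  incidence-head {L = _ ∷ _} refl = refl

  incidence-last : ∀ {v : Fin n} L → last L ≡ just c → last (incidence v L) ≡ just (lookup c v)
  incidence-last L eq = trans (last-map _ L) (cong (Maybe.map _) eq)

head-incidence-∈ : head L ≡ just c → head (incidence v L) ≡ just true → v ∈ c
head-incidence-∈ {c = c} {v = v} eq h = lookup⇒[]= v c (just-injective (trans (sym (incidence-head eq)) h))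

∈-head-incidence : head L ≡ just c → v ∈ c → head (incidence v L) ≡ just true
∈-head-incidence eq v∈ = trans (incidence-head eq) (cong just ([]=⇒lookup v∈))

last-incidence-∈ : ∀ L → last L ≡ just c → last (incidence v L) ≡ just true → v ∈ c
last-incidence-∈ {c = c} {v = v} L eq h = lookup⇒[]= v c (just-injective (trans (sym (incidence-last L eq)) h))

∈-last-incidence : ∀ L → last L ≡ just c → v ∈ c → last (incidence v L) ≡ just true
∈-last-incidence L eq v∈ = trans (incidence-last L eq) (cong just ([]=⇒lookup v∈))

head-incidence⁻ : head (incidence v L) ≡ just true → ∃ λ c → c ∈ₗ L × v ∈ c
head-incidence⁻ {L = c ∷ _} eq = c , here refl , lookup⇒[]= _ c (just-injective eq)

last-incidence⁻ : ∀ {v : Fin n} L → last (incidence v L) ≡ just true → ∃ λ c → c ∈ₗ L × v ∈ c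
last-incidence⁻ {v = v} L eq with last L in lastL
... | just c  = c , last-∈ lastL , last-incidence-∈ L lastL eq
... | nothing with () ← trans (sym eq) (trans (last-map _ L) (cong (Maybe.map _) lastL))

incidence-between : ∀ {v : Fin n} {L} xs ys zs → L ≡ xs ++ ys ++ zs → Convex (incidence v L) →
  ∀ {c₁ c₂ c₃} → c₁ ∈ₗ xs → v ∈ c₁ → c₃ ∈ₗ zs → v ∈ c₃ → c₂ ∈ₗ ys → v ∈ c₂
incidence-between {v = v} xs ys zs refl convex c₁∈ v∈c₁ c₃∈ v∈c₃ =
  incidence-All (Convex-between (incidence v xs) (incidence v ys) (incidence v zs)
                   (subst Convex (map-++₃ _ xs ys zs) convex)
                   (incidence-Any c₁∈ v∈c₁) (incidence-Any c₃∈ v∈c₃))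

-- Reversing a block of sections

module BlockReversal {G : Graph n} {T : Tree n} (mpq : IsMPQTree G T)
  (Pf Mid Rf : List (Subset n × Tree n)) (Sa Sb : Subset n) (Ta Tb : Tree n)
  (Q∈T : Q (Pf ++ (Sa , Ta) ∷ Mid ++ (Sb , Tb) ∷ Rf) ∈ₗ subtrees T)
  (left-covered  : ∀ {P′ s t v} → Pf ≡ P′ ∷ʳ (s , t) → v ∈ s → v ∈ Sa → v ∈ Sb)
  (right-covered : ∀ {R′ s t v} → Rf ≡ (s , t) ∷ R′ → v ∈ Sb → v ∈ s → v ∈ Sa)
  where

  open IsMPQTree mpq
  open Context (context Q∈T)

  children : List (Subset n × Tree n)
  children = Pf ++ (Sa , Ta) ∷ Mid ++ (Sb , Tb) ∷ Rf

  private
    f : Subset n → Subset n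
    f = above ∪_

    Ta∈ : (Sa , Ta) ∈ₗ children
    Ta∈ = ∈-++⁺ʳ Pf (here refl)

    Tb∈ : (Sb , Tb) ∈ₗ children
    Tb∈ = ∈-++⁺ʳ Pf (there (∈-++⁺ʳ Mid (here refl)))

    once : ∀ v → occ v (nodeSets (Q children)) ≤ 1
    once v = ≤-trans (occ-subtree Q∈T) (≤-reflexive (assignedOnce v))

    child-leaf : (s , t) ∈ₗ children → ∃ λ c → c ∈ₗ leaves t
    child-leaf c∈ = leaf-exists λ m →
      QNondeg⇒nonempty (qNondeg _ (subtree-trans m (subtree-trans (there (child∈subtreesQ c∈)) Q∈T)))

    ∈-above-∪ : ∀ {v} X → (v ∉ above → v ∈ X) → v ∈ f X
    ∈-above-∪ {v} X h with v ∈? above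
    ... | yes v∈ = x∈p∪q⁺ (inj₁ v∈)
    ... | no  v∉ = x∈p∪q⁺ (inj₂ (h v∉))

    outside-above : ∀ {v X} → v ∉ above → v ∈ f X → v ∈ X
    outside-above {X = X} v∉ v∈ with x∈p∪q⁻ above X v∈
    ... | inj₁ v∈above = ⊥-elim (v∉ v∈above)
    ... | inj₂ v∈X     = v∈X

    flipped : List (Subset n)
    flipped = left ++ map f (leavesQ (reverse children)) ++ right

    flipped-convex : ∀ v → Convex (incidence v flipped)
    flipped-convex = Consecutive⇒Convex (Equivalence.to (orderings _ (front-↭ front)) front)
      where front = extend (qRevF (frontQ-leaves _))

    flipped-split : ∀ K₁ K₂ → children ≡ K₁ ++ K₂ →
      flipped ≡ left ++ map f (leavesQ (reverse K₂)) ++ map f (leavesQ (reverse K₁)) ++ right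
    flipped-split K₁ K₂ eq = begin
      left ++ map f (leavesQ (reverse children)) ++ right ≡⟨ cong (λ l → left ++ map f l ++ right) reversed ⟩
      left ++ map f (X₂ ++ X₁) ++ right                   ≡⟨ cong (λ l → left ++ l ++ right) (map-++ f X₂ X₁) ⟩
      left ++ (map f X₂ ++ map f X₁) ++ right             ≡⟨ cong (left ++_) (++-assoc (map f X₂) _ right) ⟩
      left ++ map f X₂ ++ map f X₁ ++ right               ∎
      where
      X₁ = leavesQ (reverse K₁)
      X₂ = leavesQ (reverse K₂)
      reversed : leavesQ (reverse children) ≡ X₂ ++ X₁
      reversed = begin
        leavesQ (reverse children)         ≡⟨ cong (leavesQ ∘ reverse) eq ⟩
        leavesQ (reverse (K₁ ++ K₂))       ≡⟨ cong leavesQ (reverse-++ K₁ K₂) ⟩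
        leavesQ (reverse K₂ ++ reverse K₁) ≡⟨ leavesQ-++ (reverse K₂) (reverse K₁) ⟩
        X₂ ++ X₁                           ∎

    in-flipped : ∀ K {c} → c ∈ₗ leavesQ K → f c ∈ₗ map f (leavesQ (reverse K))
    in-flipped K c∈ = ∈-map⁺ f (∈-resp-↭ (↭-sym (leavesQ-reverse-↭ K)) c∈)

    -- A vertex met left of the Q-node and in a clique of an earlier child is, by the flipped
    -- front, in every clique of the later children; symmetrically on the right.
    spread-from-left : ∀ K₁ K₂ → children ≡ K₁ ++ K₂ → ∀ {v e c₁ c₂} →
      e ∈ₗ left → v ∈ e → c₁ ∈ₗ leavesQ K₁ → v ∈ f c₁ → c₂ ∈ₗ leavesQ K₂ → v ∈ f c₂
    spread-from-left K₁ K₂ eq {v} e∈ v∈e c₁∈ v∈c₁ c₂∈ =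
      incidence-between left (map f (leavesQ (reverse K₂))) (map f (leavesQ (reverse K₁)) ++ right)
        (flipped-split K₁ K₂ eq) (flipped-convex v)
        e∈ v∈e (∈-++⁺ˡ (in-flipped K₁ c₁∈)) v∈c₁ (in-flipped K₂ c₂∈)

    spread-from-right : ∀ K₁ K₂ → children ≡ K₁ ++ K₂ → ∀ {v e c₁ c₂} →
      e ∈ₗ right → v ∈ e → c₂ ∈ₗ leavesQ K₂ → v ∈ f c₂ → c₁ ∈ₗ leavesQ K₁ → v ∈ f c₁
    spread-from-right K₁ K₂ eq {v} e∈ v∈e c₂∈ v∈c₂ c₁∈ =
      incidence-between (left ++ map f (leavesQ (reverse K₂))) (map f (leavesQ (reverse K₁))) right
        (trans (flipped-split K₁ K₂ eq) (sym (++-assoc left _ _))) (flipped-convex v)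
        (∈-++⁺ʳ left (in-flipped K₂ c₂∈)) v∈c₂ e∈ v∈e (in-flipped K₁ c₁∈)

  module _ {cy cz : Subset n} {ra rb} (Ta≡ : leaves Ta ≡ cy ∷ ra) (Tb≡ : leaves Tb ≡ rb ∷ʳ cz) where

    private
      block : List (Subset n × Tree n)
      block = ((Sa , Ta) ∷ Mid) ∷ʳ (Sb , Tb)

      Lx Ly Lz : List (Subset n)
      Lx = left ++ map f (leavesQ Pf)
      Ly = map f (leavesQ block)
      Lz = map f (leavesQ Rf) ++ right

      y₀ z₀ : Subset n
      y₀ = f (Sa ∪ cy)
      z₀ = f (Sb ∪ cz)

      cy∈ : cy ∈ₗ leaves Ta
      cy∈ = subst (cy ∈ₗ_) (sym Ta≡) (here refl)

      cz∈ : cz ∈ₗ leaves Tb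
      cz∈ = subst (cz ∈ₗ_) (sym Tb≡) (∈-++⁺ʳ rb (here refl))

      head-Ly : head Ly ≡ just y₀
      head-Ly = head-leavesQ {t = Ta} f (Mid ∷ʳ (Sb , Tb)) Ta≡

      last-Ly : last Ly ≡ just z₀
      last-Ly = last-leavesQ {t = Tb} f ((Sa , Ta) ∷ Mid) Tb≡

      y₀∈Ly : y₀ ∈ₗ Ly
      y₀∈Ly = ∈-map⁺ f (leavesQ-∈ block (here refl) cy∈)

      y₀<z₀ : Before y₀ z₀ Ly
      y₀<z₀ = Before-map f (Before-++ (∈-map⁺ (Sa ∪_) cy∈)
                                      (leavesQ-∈ (Mid ∷ʳ (Sb , Tb)) (∈-++⁺ʳ Mid (here refl)) cz∈))

      leaves-T : leaves T ≡ Lx ++ Ly ++ Lz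
      leaves-T = begin
        leaves T                                                  ≡⟨ leaves-split ⟩
        left ++ map f (leavesQ children) ++ right                 ≡⟨ cong (λ l → left ++ map f l ++ right) split ⟩
        left ++ map f (leavesQ Pf ++ leavesQ block ++ leavesQ Rf) ++ right
                                        ≡⟨ cong (λ l → left ++ l ++ right) (map-++₃ f (leavesQ Pf) (leavesQ block) _) ⟩
        left ++ (map f (leavesQ Pf) ++ Ly ++ map f (leavesQ Rf)) ++ right ≡⟨ ++-regroup left _ Ly _ right ⟩
        Lx ++ Ly ++ Lz                                            ∎
        where
        split : leavesQ children ≡ leavesQ Pf ++ leavesQ block ++ leavesQ Rf
        split = begin
          leavesQ children                          ≡⟨ cong (leavesQ ∘ (Pf ++_) ∘ ((Sa , Ta) ∷_)) (sym (++-assoc Mid _ Rf)) ⟩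
          leavesQ (Pf ++ block ++ Rf)               ≡⟨ leavesQ-++ Pf (block ++ Rf) ⟩
          leavesQ Pf ++ leavesQ (block ++ Rf)       ≡⟨ cong (leavesQ Pf ++_) (leavesQ-++ block Rf) ⟩
          leavesQ Pf ++ leavesQ block ++ leavesQ Rf ∎

      left-boundary : ∀ v → last (incidence v Lx) ≡ just true → v ∈ y₀ → v ∈ z₀
      left-boundary v v∈Lx v∈y₀ with initLast Pf
      ... | [] with last-incidence⁻ (left ++ []) v∈Lx
      ...   | e , e∈ , v∈e =
        spread-from-left ((Sa , Ta) ∷ []) (Mid ++ (Sb , Tb) ∷ Rf) refl
          (subst (e ∈ₗ_) (++-identityʳ left) e∈) v∈e (leavesQ-∈ ((Sa , Ta) ∷ []) (here refl) cy∈) v∈y₀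
          (leavesQ-∈ (Mid ++ (Sb , Tb) ∷ Rf) (∈-++⁺ʳ Mid (here refl)) cz∈)
      left-boundary v v∈Lx v∈y₀ | P′ ∷ʳ′ (s₁ , t₁) with child-leaf (∈-++⁺ˡ (∈-++⁺ʳ P′ (here refl)))
      ... | _ , c∈ with ∈⇒∷ʳ c∈
      ... | _ , cx , t₁≡ = ∈-above-∪ (Sb ∪ cz) (λ v∉ → x∈p∪q⁺ (inj₁ (covered v∉)))
        where
        cx∈ : cx ∈ₗ leaves t₁
        cx∈ = subst (cx ∈ₗ_) (sym t₁≡) (∈-++⁺ʳ _ (here refl))
        v∈x : v ∈ f (s₁ ∪ cx)
        v∈x = last-incidence-∈ Lx (last-++ left (last-leavesQ {t = t₁} f P′ t₁≡)) v∈Lx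
        covered : v ∉ above → v ∈ Sb
        covered v∉ with Q-cliques-sections (P′ ∷ʳ (s₁ , t₁)) _ (once v) (∈-++⁺ʳ P′ (here refl)) (here refl)
                          cx∈ cy∈ (outside-above v∉ v∈x) (outside-above v∉ v∈y₀)
        ... | v∈s₁ , v∈Sa = left-covered refl v∈s₁ v∈Sa

      right-boundary : ∀ v → head (incidence v Lz) ≡ just true → v ∈ z₀ → v ∈ y₀
      right-boundary v v∈Lz v∈z₀ with []-or-∷ Rf
      ... | inj₁ refl with head-incidence⁻ v∈Lz
      ...   | e , e∈ , v∈e =
        spread-from-right (Pf ++ (Sa , Ta) ∷ Mid) ((Sb , Tb) ∷ []) (sym (++-assoc Pf _ _))
          e∈ v∈e (leavesQ-∈ ((Sb , Tb) ∷ []) (here refl) cz∈) v∈z₀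
          (leavesQ-∈ (Pf ++ (Sa , Ta) ∷ Mid) (∈-++⁺ʳ Pf (here refl)) cy∈)
      right-boundary v v∈Lz v∈z₀ | inj₂ ((s₂ , t₂) , R′ , refl)
        with child-leaf (∈-++⁺ʳ Pf (there (∈-++⁺ʳ Mid (there (here refl)))))
      ... | _ , c∈ with ∈⇒∷ c∈
      ... | cw , _ , t₂≡ = ∈-above-∪ (Sa ∪ cy) (λ v∉ → x∈p∪q⁺ (inj₁ (covered v∉)))
        where
        cw∈ : cw ∈ₗ leaves t₂
        cw∈ = subst (cw ∈ₗ_) (sym t₂≡) (here refl)
        v∈w : v ∈ f (s₂ ∪ cw)
        v∈w = head-incidence-∈ (head-++ (head-leavesQ {t = t₂} f R′ t₂≡)) v∈Lz
        K₁ : List (Subset n × Tree n)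
        K₁ = Pf ++ (Sa , Ta) ∷ (Mid ∷ʳ (Sb , Tb))
        regroup : children ≡ K₁ ++ (s₂ , t₂) ∷ R′
        regroup = trans (cong (λ l → Pf ++ (Sa , Ta) ∷ l) (sym (++-assoc Mid _ _))) (sym (++-assoc Pf _ _))
        covered : v ∉ above → v ∈ Sa
        covered v∉ with Q-cliques-sections K₁ _ (subst (λ ks → occ v (nodeSets (Q ks)) ≤ 1) regroup (once v))
                          (∈-++⁺ʳ Pf (there (∈-++⁺ʳ Mid (here refl)))) (here refl)
                          cz∈ cw∈ (outside-above v∉ v∈z₀) (outside-above v∉ v∈w)
        ... | v∈Sb , v∈s₂ = right-covered refl v∈Sb v∈s₂

      L′ : List (Subset n)
      L′ = Lx ++ reverse Ly ++ Lz

      L′↭ : L′ ↭ leaves T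
      L′↭ = ↭-trans (++⁺ˡ Lx (++⁺ʳ Lz (↭-reverse Ly))) (↭-reflexive (sym leaves-T))

      L′-convex : ∀ v → Convex (incidence v L′)
      L′-convex v = subst Convex (sym incidence-L′)
        (Convex-reverse-middle (inc Lx) (inc Ly) (inc Lz) canonical
          (λ v∈Lx v∈y₀ → ∈-last-incidence Ly last-Ly (left-boundary v v∈Lx (head-incidence-∈ head-Ly v∈y₀)))
          (λ v∈Lz v∈z₀ → ∈-head-incidence head-Ly (right-boundary v v∈Lz (last-incidence-∈ Ly last-Ly v∈z₀))))
        where
        inc = incidence v
        canonical : Convex (inc Lx ++ inc Ly ++ inc Lz)
        canonical = subst Convex (trans (cong inc leaves-T) (map-++₃ _ Lx Ly Lz))
                      (Consecutive⇒Convex (Equivalence.to (orderings _ ↭-refl) (front-leaves T)) v)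
        incidence-L′ : inc L′ ≡ inc Lx ++ reverse (inc Ly) ++ inc Lz
        incidence-L′ = trans (map-++₃ _ Lx (reverse Ly) Lz)
                             (cong (λ l → inc Lx ++ l ++ inc Lz) (reverse-map _ Ly))

      L′-front : Front T L′
      L′-front = Equivalence.from (orderings L′ L′↭) (Convex⇒Consecutive L′-convex)

      L′-unique : Unique L′
      L′-unique = PermutationSetoid.Unique-resp-↭ (setoid _) (↭⇒↭ₛ (↭-sym L′↭)) leavesUnique

      z₀<y₀ : Before z₀ y₀ L′
      z₀<y₀ = Before-++ʳ Lx (Before-++ˡ (Before-reverse y₀<z₀))

      no-left-neighbour : ∀ {P′ e} → Pf ≢ P′ ∷ʳ e
      no-left-neighbour {P′} {s₁ , t₁} refl with child-leaf (∈-++⁺ˡ (∈-++⁺ʳ P′ (here refl)))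
      ... | cx , cx∈ with order
        where
        order : Between (f (s₁ ∪ cx)) y₀ z₀ L′
        order = Between-context (context Q∈T)
          (λ front → Q-Between (P′ ∷ʳ (s₁ , t₁)) ((Sa , Ta) ∷ Mid) ((Sb , Tb) ∷ Rf) front
                       (∈-++⁺ʳ P′ (here refl)) (here refl) (here refl) cx∈ cy∈ cz∈) L′-front
      ... | inj₁ (_ , y₀<z₀′) = Before-asym L′-unique y₀<z₀′ z₀<y₀
      ... | inj₂ (_ , y₀<x)   = Before-asym L′-unique x<y₀ y₀<x
        where
        x<y₀ : Before (f (s₁ ∪ cx)) y₀ L′
        x<y₀ = Before-++ (∈-++⁺ʳ left (∈-map⁺ f (leavesQ-∈ (P′ ∷ʳ (s₁ , t₁)) (∈-++⁺ʳ P′ (here refl)) cx∈)))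
                         (∈-++⁺ˡ (Any.reverse⁺ y₀∈Ly))

      no-right-neighbour : ∀ {e R′} → Rf ≢ e ∷ R′
      no-right-neighbour {s₂ , t₂} {R′} refl
        with child-leaf (∈-++⁺ʳ Pf (there (∈-++⁺ʳ Mid (there (here refl)))))
      ... | cw , cw∈ with order
        where
        order : Between y₀ z₀ (f (s₂ ∪ cw)) L′
        order = Between-context (context Q∈T)
          (λ front → Q-Between (Pf ++ (Sa , Ta) ∷ Mid) ((Sb , Tb) ∷ []) ((s₂ , t₂) ∷ R′)
                       (subst (λ ks → Front (Q ks) _) (sym (++-assoc Pf _ _)) front)
                       (∈-++⁺ʳ Pf (here refl)) (here refl) (here refl) cy∈ cz∈ cw∈) L′-front
      ... | inj₁ (y₀<z₀′ , _) = Before-asym L′-unique y₀<z₀′ z₀<y₀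
      ... | inj₂ (w<z₀ , _)   = Before-asym L′-unique z₀<w w<z₀
        where
        w∈Lz : f (s₂ ∪ cw) ∈ₗ Lz
        w∈Lz = ∈-++⁺ˡ (∈-map⁺ f (leavesQ-∈ ((s₂ , t₂) ∷ R′) (here refl) cw∈))
        z₀<w : Before z₀ (f (s₂ ∪ cw)) L′
        z₀<w = Before-++ʳ Lx (Before-++ (Any.reverse⁺ (Before-∈ y₀<z₀)) w∈Lz)

    block-spans-node′ : Pf ≡ [] × Rf ≡ []
    block-spans-node′ with initLast Pf | []-or-∷ Rf
    ... | _ ∷ʳ′ _ | _                 = ⊥-elim (no-left-neighbour refl)
    ... | []      | inj₂ (_ , _ , eq) = ⊥-elim (no-right-neighbour eq)
    ... | []      | inj₁ eq           = refl , eq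

  block-spans-node : Pf ≡ [] × Rf ≡ []
  block-spans-node with child-leaf Ta∈ | child-leaf Tb∈
  ... | _ , cy∈ | _ , cz∈ with ∈⇒∷ cy∈ | ∈⇒∷ʳ cz∈
  ... | _ , _ , Ta≡ | _ , _ , Tb≡ = block-spans-node′ Ta≡ Tb≡

split-at : ∀ {A : Set} (xs : List A) i → i < length xs →
  ∃₂ λ ys y → ∃ λ zs → xs ≡ ys ++ y ∷ zs × length ys ≡ i
split-at (x ∷ xs) zero    _        = [] , x , xs , refl , refl
split-at (x ∷ xs) (suc i) (s≤s i<) with split-at xs i i<
... | ys , y , zs , refl , refl = x ∷ ys , y , zs , refl , refl

sec-at : ∀ (xs : List (Subset n × Tree n)) {s t ys} → sec (xs ++ (s , t) ∷ ys) (suc (length xs)) ≡ s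
sec-at []       = refl
sec-at (_ ∷ xs) = sec-at xs

Separates : List (Subset n × Tree n) → ℕ → ℕ → Fin n → Set
Separates ss a b v = (v ∈ sec ss (a ∸ 1) × v ∈ sec ss a × v ∉ sec ss b) ⊎
                     (v ∈ sec ss b × v ∈ sec ss (b + 1) × v ∉ sec ss a)

separates? : ∀ (ss : List (Subset n × Tree n)) a b → Decidable (Separates ss a b)
separates? ss a b v = (v ∈? sec ss (a ∸ 1) ×-dec v ∈? sec ss a ×-dec ¬? (v ∈? sec ss b)) ⊎-dec
                      (v ∈? sec ss b ×-dec v ∈? sec ss (b + 1) ×-dec ¬? (v ∈? sec ss a))

separating-vertex : ∀ {G : Graph n} {T : Tree n} {ss a b} → IsMPQTree G T → Q ss ∈ₗ subtrees T →
  ∀ Pf Sa Ta Mid Sb Tb Rf → ss ≡ (Pf ++ (Sa , Ta) ∷ Mid) ++ (Sb , Tb) ∷ Rf →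
  a ≡ suc (length Pf) → b ≡ suc (length (Pf ++ (Sa , Ta) ∷ Mid)) → ¬ (Pf ≡ [] × Rf ≡ []) →
  ∃ (Separates ss a b)
separating-vertex {T = T} {ss} {a} {b} mpq Q∈T Pf Sa Ta Mid Sb Tb Rf refl refl refl not-whole
  with any? (separates? ss a b)
... | yes separator = separator
... | no none = ⊥-elim (not-whole (BlockReversal.block-spans-node mpq Pf Mid Rf Sa Sb Ta Tb
                          (subst (λ ks → Q ks ∈ₗ subtrees T) (++-assoc Pf _ _) Q∈T) left-covered right-covered))
  where
  K = Pf ++ (Sa , Ta) ∷ Mid
  sec-a : sec ss a ≡ Sa
  sec-a = trans (cong (λ ks → sec ks a) (++-assoc Pf _ _)) (sec-at Pf)
  sec-b : sec ss b ≡ Sb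
  sec-b = sec-at K
  left-covered : ∀ {P′ s t v} → Pf ≡ P′ ∷ʳ (s , t) → v ∈ s → v ∈ Sa → v ∈ Sb
  left-covered {P′} {s} {t} {v} refl v∈s v∈Sa with v ∈? Sb
  ... | yes v∈Sb = v∈Sb
  ... | no  v∉Sb = ⊥-elim (none (v , inj₁ ( subst (v ∈_) (sym sec-left) v∈s
                                           , subst (v ∈_) (sym sec-a) v∈Sa
                                           , v∉Sb ∘ subst (v ∈_) sec-b )))
    where
    sec-left : sec ss (length Pf) ≡ s
    sec-left = trans (cong₂ sec (trans (++-assoc (P′ ∷ʳ (s , t)) _ _) (++-assoc P′ ((s , t) ∷ []) _))
                                (trans (length-++ P′) (+-comm (length P′) 1)))
                     (sec-at P′)
  right-covered : ∀ {R′ s t v} → Rf ≡ (s , t) ∷ R′ → v ∈ Sb → v ∈ s → v ∈ Sa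
  right-covered {R′} {s} {t} {v} refl v∈Sb v∈s with v ∈? Sa
  ... | yes v∈Sa = v∈Sa
  ... | no  v∉Sa = ⊥-elim (none (v , inj₂ ( subst (v ∈_) (sym sec-b) v∈Sb
                                           , subst (v ∈_) (sym sec-right) v∈s
                                           , v∉Sa ∘ subst (v ∈_) sec-a )))
    where
    sec-right : sec ss (b + 1) ≡ s
    sec-right = trans (cong₂ sec (sym (++-assoc K ((Sb , Tb) ∷ []) _)) (cong suc (sym (length-++ K))))
                      (sec-at (K ∷ʳ (Sb , Tb)))

lemma19 : ∀ {n} (G : Graph n) → IsIntervalGraph G → (T : Tree n) → IsMPQTree G T →
          (ss : List (Subset n × Tree n)) → Q ss LM.∈ subtrees T →
          (a b : ℕ) → 1 ≤ a → a < b → b ≤ length ss → ¬ (a ≡ 1 × b ≡ length ss) →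
          ∃ λ (v : Fin n) →
            (v ∈ sec ss (a ∸ 1) × v ∈ sec ss a × v ∉ sec ss b) ⊎
            (v ∈ sec ss b × v ∈ sec ss (b + 1) × v ∉ sec ss a)
lemma19 G _ T mpq ss Q∈T (suc a) (suc b) (s≤s z≤n) (s≤s a<b) b<k not-whole
  with split-at ss b b<k
... | K , (Sb , Tb) , Rf , refl , refl with split-at K a a<b
... | Pf , (Sa , Ta) , Mid , refl , refl =
  separating-vertex mpq Q∈T Pf Sa Ta Mid Sb Tb Rf refl refl refl
    λ { (refl , refl) → not-whole (refl , last-index) }
  where
  last-index : suc (length K) ≡ length (K ++ (Sb , Tb) ∷ [])
  last-index = sym (trans (length-++-sucʳ K (Sb , Tb) []) (cong (suc ∘ length) (++-identityʳ K)))
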